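{- Let $G=K_{s,t}$ be a complete bipartite graph with $1\le s \leq t$. (a) If $s=1$ then $\delta^-(G)=\infty$, and if $s \geq 2$ then $\delta^-(G)=1$. (b) If $s=1$ and $t \geq 4$, or if $s \geq 2$ and $t \geq 3$, then $\delta^+(G)=1$. In the other cases (namely when $(s,t) = (1,1), (1,2), (1,3)$ or $(2,2)$), we have $\delta^+(G)=\infty$. (c) If $s=1$ and $t \geq 4$, or if $s \geq 2$, then $\delta(G)=1$. If $(s,t) = (1,1)$ or $(1,2)$ then $\delta(G)=\infty$, and if $(s,t)=(1,3)$ then $\delta(G)=2$.
   Context: All graphs are finite and simple. For a graph $G=(V,E)$ with $m \geq 1$ edges, degrees $d_v$, for $A\subseteq V$ let ${\rm vol}(A)=\sum_{v\in A} d_v$ and let $e(A)$ be the number of edges with both ends in $A$. For a partition $\mathcal{A}$ of $V$, the modularity score is $q_{\mathcal A}(G)=\frac{1}{m}\sum_{A\in\mathcal A} e(A)-\frac{1}{4m^2}\sum_{A\in\mathcal A}{\rm vol}(A)^2$, and the modularity is $q^*(G)=\max_{\mathcal A} q_{\mathcal A}(G)$. A graph with no edges has $q^*(G)=0$. For a graph $H$: $\delta^-(H)$ is the least number of edges one can delete from $H$ to obtain a subgraph $H'$ (on the same vertex set) with $q^*(H')>0$, and $\delta^-(H)=\infty$ if no such subgraph exists; $\delta^+(H)$ is the least number of edges one can add to $H$ (between existing vertices) to obtain a graph $H'$ with $q^*(H')>0$, and $\delta^+(H)=\infty$ if none exists; $\delta(H)$ is the least number of edits (each edit adding or removing one edge,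 vertex set fixed) needed to obtain a graph $H'$ with $q^*(H')>0$, and $\delta(H)=\infty$ if none exists. -}

module Defs where

open import Data.Bool using (Bool; true; false; _∧_; _xor_; if_then_else_)
open import Data.Nat using (ℕ; zero; suc; _+_; _*_; _<ᵇ_; _≤_; NonZero)
open import Data.Fin using (Fin; toℕ; _≟_)
open import Data.List using (List; []; _∷_; map; allFin)
open import Data.Nat.ListAction using (sum)
open import Data.Nat.Properties using (m*n≢0)
open import Data.Integer using (+_)
open import Data.Rational using (ℚ; _/_; _-_; 0ℚ; _<_) renaming (_+_ to _+ℚ_)
open import Data.Unit using (⊤)
open import Data.Product using (Σ; ∃; _×_)
open import Relation.Nullary using (¬_; does)
open import Relation.Binary.PropositionalEquality using (_≡_; refl)

record Graph (n : ℕ) : Set where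
  field
    adj   : Fin n → Fin n → Bool
    sym   : ∀ i j → adj i j ≡ adj j i
    irrefl : ∀ i → adj i i ≡ false
open Graph public

Σᵥ : ∀ {n} → (Fin n → ℕ) → ℕ
Σᵥ {n} f = sum (map f (allFin n))

[_] : Bool → ℕ
[ true ] = 1
[ false ] = 0

-- indicator of i < j (so that each unordered pair is counted once)
lt : ∀ {n} → Fin n → Fin n → Bool
lt i j = toℕ i <ᵇ toℕ j

edges : ∀ {n} → Graph n → ℕ
edges G = Σᵥ λ i → Σᵥ λ j → [ lt i j ∧ adj G i j ]

deg : ∀ {n} → Graph n → Fin n → ℕ
deg G v = Σᵥ λ j → [ adj G v j ]

Subset : ℕ → Set
Subset n = Fin n → Bool

vol : ∀ {n} → Graph n → Subset n → ℕ
vol G A = Σᵥ λ v → if A v then deg G v else 0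

eIn : ∀ {n} → Graph n → Subset n → ℕ
eIn G A = Σᵥ λ i → Σᵥ λ j → [ lt i j ∧ adj G i j ∧ A i ∧ A j ]

-- A partition of V is given by a labelling c : V → Fin n; its parts are the
-- (nonempty) fibres  A_k = c⁻¹(k).  Empty fibres contribute 0 to the score,
-- and every partition of V (at most n parts) arises this way.
Partition : ℕ → Set
Partition n = Fin n → Fin n

part : ∀ {n} → Partition n → Fin n → Subset n
part c k v = does (c v ≟ k)

Σℚ : List ℚ → ℚ
Σℚ [] = 0ℚ
Σℚ (x ∷ xs) = x +ℚ Σℚ xs

score : ∀ {n} (G : Graph n) → .{{NonZero (edges G)}} → Partition n → ℚ
score {n} G c =
  ((+ Σᵥ (λ k → eIn G (part c k))) / edges G)
  - ((+ Σᵥ (λ k → vol G (part c k) * vol G (part c k))) / (4 * (edges G * edges G)))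
  where instance
    nz4 : NonZero (4 * (edges G * edges G))
    nz4 = m*n≢0 4 (edges G * edges G) {{_}} {{m*n≢0 (edges G) (edges G)}}

-- q*(G) > 0 : G has an edge and the maximum over partitions of the score is
-- positive, i.e. some partition has positive score (edgeless graphs: q* = 0).
PosMod : ∀ {n} → Graph n → Set
PosMod G = Σ (NonZero (edges G)) λ nz → ∃ λ (c : Partition _) → 0ℚ < score G {{nz}} c

dist : ∀ {n} → Graph n → Graph n → ℕ
dist G H = Σᵥ λ i → Σᵥ λ j → [ lt i j ∧ (adj G i j xor adj H i j) ]

Deletion : ∀ {n} → Graph n → Graph n → Set
Deletion H H' = ∀ i j → adj H' i j ≡ true → adj H i j ≡ true

Addition : ∀ {n} → Graph n → Graph n → Set
Addition H H' = ∀ i j → adj H i j ≡ true → adj H' i j ≡ true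

AnyEdit : ∀ {n} → Graph n → Graph n → Set
AnyEdit H H' = ⊤

data ℕ∞ : Set where
  fin : ℕ → ℕ∞
  ∞   : ℕ∞

-- "δ_R(H) = d": least number of edits over R-modifications H' with q*(H') > 0
HasDelta : ∀ {n} → (Graph n → Graph n → Set) → Graph n → ℕ∞ → Set
HasDelta R H ∞ = ∀ H' → R H H' → ¬ PosMod H'
HasDelta R H (fin k) =
  (∃ λ H' → R H H' × PosMod H' × dist H H' ≡ k)
  × (∀ H' → R H H' → PosMod H' → k ≤ dist H H')

δ⁻_≡_ : ∀ {n} → Graph n → ℕ∞ → Set
δ⁻ H ≡ d = HasDelta Deletion H d

δ⁺_≡_ : ∀ {n} → Graph n → ℕ∞ → Set
δ⁺ H ≡ d = HasDelta Addition H d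

δ_≡_ : ∀ {n} → Graph n → ℕ∞ → Set
δ H ≡ d = HasDelta AnyEdit H d

-- complete bipartite graph K_{s,t} on Fin (s + t): parts {0..s-1} and {s..s+t-1}
xor-sym : ∀ a b → (a xor b) ≡ (b xor a)
xor-sym true true = refl
xor-sym true false = refl
xor-sym false true = refl
xor-sym false false = refl

xor-self : ∀ a → (a xor a) ≡ false
xor-self true = refl
xor-self false = refl

K : (s t : ℕ) → Graph (s + t)
K s t = record
  { adj = λ i j → (toℕ i <ᵇ s) xor (toℕ j <ᵇ s)
  ; sym = λ i j → xor-sym (toℕ i <ᵇ s) (toℕ j <ᵇ s)
  ; irrefl = λ i → xor-self (toℕ i <ᵇ s)
  }

-- A part A of a partition contributes e(A)/m − (vol A / 2m)² to the modularity score.  In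
-- K_{s,t}, a set with a left and b right vertices has e(A) = ab and vol A = ta + sb, so
-- 4m·e(A) − (vol A)² = 4(ta)(sb) − (ta + sb)² ≤ 0 by AM–GM; the same computation applies to
-- subgraphs of stars.  Hence these graphs have modularity 0, which gives δ⁻(K_{1,t}) = ∞ and
-- the lower bounds δ ≥ 1.  Conversely, in a bipartition {A, Ā} both parts contribute the same
-- amount 4e(A)e(Ā) − cut², so a single set with positive contribution yields positive
-- modularity.  Deleting an edge between A and Ā, or adding one inside A, turns the contribution
-- of A into 4b(s − a) − (ta − sb − 1)², resp. 4(s − a)(t − b) − (ta − sb)² (scaled by 4m²),
-- which is positive when A nearly balances the AM–GM terms: a = ⌈s/2⌉, b = ⌊ta/s⌋.  The
-- remaining cases concern graphs on at most four vertices and are settled by exhaustive search.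

module Submission where

open import Data.Bool using (Bool; true; false; _∧_; _∨_; not; _xor_; if_then_else_)
import Data.Bool.Properties as Bool
open import Data.Bool.Properties
  using (T-≡; ¬-not; ∧-zeroʳ; ∧-assoc; ∧-comm; ∨-comm; xor-assoc; xor-same; xor-identityʳ)
open import Data.Empty using (⊥-elim)
open import Data.Fin using (Fin; zero; suc; toℕ; _↑ˡ_; _↑ʳ_; _≟_; splitAt; fromℕ<)
open import Data.Fin.Patterns using (0F; 2F; 3F)
open import Data.Fin.Properties
  using (all?; toℕ-injective; toℕ<n; toℕ-↑ˡ; toℕ-↑ʳ; splitAt-↑ˡ; splitAt-↑ʳ; toℕ-fromℕ<)
open import Data.List using (List; []; _∷_; tabulate; cartesianProductWith)
open import Data.List.Membership.Propositional using (_∈_)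
open import Data.List.Membership.Propositional.Properties using (∈-cartesianProductWith⁺)
open import Data.List.Properties using (map-tabulate)
open import Data.List.Relation.Unary.All using (All)
import Data.List.Relation.Unary.All as All
open import Data.List.Relation.Unary.Any using (here; there)
open import Data.Nat
  using (ℕ; zero; suc; _+_; _*_; _∸_; _≤_; _<_; _≥_; _<ᵇ_; z≤n; s≤s; s≤s⁻¹
        ; NonZero; >-nonZero; ⌊_/2⌋; ⌈_/2⌉)
import Data.Nat as ℕ
open import Data.Nat.DivMod using (m≡m%n+[m/n]*n; m%n<n)
import Data.Nat.ListAction as List
open import Data.Nat.Properties
  using ( +-identityʳ; +-comm; +-assoc; +-cancelˡ-≡; +-cancelˡ-<; +-cancelʳ-<
        ; +-mono-≤; +-monoˡ-≤; +-monoʳ-≤; +-mono-<; +-monoˡ-<; +-monoʳ-<; +-mono-<-≤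
        ; *-identityʳ; *-zeroʳ; *-comm; *-assoc; *-suc; *-distribˡ-+; *-distribʳ-+; m*n≢0
        ; *-mono-≤; *-monoˡ-≤; *-monoʳ-≤; *-mono-<; *-monoˡ-<; *-monoʳ-<
        ; *-cancelʳ-≤; *-cancelˡ-<; *-cancelʳ-<
        ; ≤-refl; ≤-trans; ≤-antisym; ≤-total; <-≤-trans; ≤-<-trans; <-asym; <-irrefl
        ; <⇒≤; <⇒≱; ≮⇒≥; ≰⇒>; m≤n⇒m<n∨m≡n; m≤m+n; m≤n+m; m<m+n; n≢0⇒n>0; m≤n⇒∃[o]m+o≡n
        ; m+n≡0⇒m≡0; m+n≡0⇒n≡0; m+[n∸m]≡n; _≤?_; ≤ᵇ⇒≤; <⇒<ᵇ; <ᵇ-reflects-<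
        ; ⌊n/2⌋+⌈n/2⌉≡n; ⌊n/2⌋≤⌈n/2⌉; ⌊n/2⌋-mono; ⌈n/2⌉≤n; +-*-semiring; module ≤-Reasoning )
open import Data.Nat.Tactic.RingSolver using (solve; solve-∀)
open import Data.Product using (∃; _×_; _,_)
open import Data.Sum using (_⊎_; inj₁; inj₂; [_,_]′)
open import Data.Unit using (⊤; tt)
import Data.Vec.Functional as Vec
open import Defs hiding (sym)
open import Function using (_∘_; id; case_of_; Equivalence; _⇔_; mk⇔)
open import Relation.Binary.PropositionalEquality
  using (_≡_; refl; sym; trans; cong; cong₂; subst; subst₂; module ≡-Reasoning)
open import Relation.Nullary using (¬_; does; ofʸ; ofⁿ; yes)
open import Relation.Nullary.Decidable using (Dec; dec-true; map′; True; toWitness; _→-dec_; _⊎-dec_)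

open import Algebra.Properties.Semiring.Sum +-*-semiring
  using (sum; sum-syntax; sum-cong-≗; ∑-distrib-+; ∑-comm; *-distribˡ-sum; *-distribʳ-sum)

sum-tabulate : ∀ n (f : Fin n → ℕ) → List.sum (tabulate f) ≡ ∑[ i < n ] f i
sum-tabulate zero    f = refl
sum-tabulate (suc n) f = cong (f zero +_) (sum-tabulate n (f ∘ suc))

Σᵥ≡∑ : ∀ {n} (f : Fin n → ℕ) → Σᵥ f ≡ ∑[ i < n ] f i
Σᵥ≡∑ {n} f = trans (cong List.sum (map-tabulate id f)) (sum-tabulate n f)

ΣᵥΣᵥ≡∑∑ : ∀ {n} (f : Fin n → Fin n → ℕ) → Σᵥ (λ i → Σᵥ (f i)) ≡ ∑[ i < n ] ∑[ j < n ] f i j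
ΣᵥΣᵥ≡∑∑ f = trans (Σᵥ≡∑ (λ i → Σᵥ (f i))) (sum-cong-≗ (λ i → Σᵥ≡∑ (f i)))

∑-const : ∀ n c → ∑[ i < n ] c ≡ n * c
∑-const zero    c = refl
∑-const (suc n) c = cong (c +_) (∑-const n c)

∑-zero : ∀ {n} {f : Fin n → ℕ} → (∀ i → f i ≡ 0) → ∑[ i < n ] f i ≡ 0
∑-zero {n} f≗0 = trans (sum-cong-≗ f≗0) (trans (∑-const n 0) (*-zeroʳ n))

∑≡0⇒ : ∀ {n} (f : Fin n → ℕ) → ∑[ i < n ] f i ≡ 0 → ∀ i → f i ≡ 0
∑≡0⇒ f ∑f≡0 zero    = m+n≡0⇒m≡0 (f zero) ∑f≡0
∑≡0⇒ f ∑f≡0 (suc i) = ∑≡0⇒ (f ∘ suc) (m+n≡0⇒n≡0 (f zero) ∑f≡0) i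

∑-mono-≤ : ∀ {n} {f g : Fin n → ℕ} → (∀ i → f i ≤ g i) → ∑[ i < n ] f i ≤ ∑[ i < n ] g i
∑-mono-≤ {zero}  f≤g = z≤n
∑-mono-≤ {suc n} f≤g = +-mono-≤ (f≤g zero) (∑-mono-≤ (f≤g ∘ suc))

∑∑-distrib-+ : ∀ {m n} (f g : Fin m → Fin n → ℕ) →
               ∑[ i < m ] ∑[ j < n ] (f i j + g i j)
               ≡ ∑[ i < m ] ∑[ j < n ] f i j + ∑[ i < m ] ∑[ j < n ] g i j
∑∑-distrib-+ f g = trans (sum-cong-≗ λ i → ∑-distrib-+ (f i) (g i))
                         (∑-distrib-+ (λ i → sum (f i)) (λ i → sum (g i)))

∑∑-product : ∀ {m n} (f : Fin m → ℕ) (g : Fin n → ℕ) →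
             ∑[ i < m ] ∑[ j < n ] (f i * g j) ≡ ∑[ i < m ] f i * ∑[ j < n ] g j
∑∑-product f g = trans (sum-cong-≗ λ i → sym (*-distribˡ-sum (f i) g)) (sym (*-distribʳ-sum (sum g) f))

∑-↑ : ∀ s {t} (f : Fin (s + t) → ℕ) →
      ∑[ i < s + t ] f i ≡ ∑[ i < s ] f (i ↑ˡ t) + ∑[ j < t ] f (s ↑ʳ j)
∑-↑ zero    f = refl
∑-↑ (suc s) f = trans (cong (f zero +_) (∑-↑ s (f ∘ suc))) (sym (+-assoc (f zero) _ _))

∑-point : ∀ {n} (u : Fin n) (f : Fin n → ℕ) → ∑[ i < n ] ([ does (i ≟ u) ] * f i) ≡ f u
∑-point {suc n} zero    f =
  trans (cong (f zero + 0 +_) (∑-zero {f = λ i → [ does (suc i ≟ zero) ] * f (suc i)} λ _ → refl))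
        (trans (+-identityʳ _) (+-identityʳ (f zero)))
∑-point {suc n} (suc u) f = ∑-point u (f ∘ suc)

∑-count : ∀ {n k} → k ≤ n → ∑[ i < n ] [ toℕ i <ᵇ k ] ≡ k
∑-count {n}     {zero}  _         = ∑-zero {n} {λ i → [ toℕ i <ᵇ 0 ]} λ _ → refl
∑-count {suc n} {suc k} (s≤s k≤n) = cong suc (∑-count k≤n)

[∧] : ∀ a b → [ a ∧ b ] ≡ [ a ] * [ b ]
[∧] false b = refl
[∧] true  b = sym (+-identityʳ [ b ])

<ᵇ-true : ∀ {m n} → m < n → (m <ᵇ n) ≡ true
<ᵇ-true m<n = Equivalence.to T-≡ (<⇒<ᵇ m<n)

<ᵇ-false : ∀ {m n} → n ≤ m → (m <ᵇ n) ≡ false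
<ᵇ-false {m} {n} n≤m with m <ᵇ n | <ᵇ-reflects-< m n
... | false | _       = refl
... | true  | ofʸ m<n = ⊥-elim (<⇒≱ m<n n≤m)

edgeInd : ∀ {n} → Graph n → Fin n → Fin n → ℕ
edgeInd G i j = [ lt i j ∧ adj G i j ]

edgeSum : ∀ {n} → Graph n → (Fin n → Fin n → ℕ) → ℕ
edgeSum {n} G g = ∑[ i < n ] ∑[ j < n ] (edgeInd G i j * g i j)

adj-split : ∀ {n} (G : Graph n) i j → [ adj G i j ] ≡ edgeInd G i j + edgeInd G j i
adj-split G i j with lt i j | <ᵇ-reflects-< (toℕ i) (toℕ j) | lt j i | <ᵇ-reflects-< (toℕ j) (toℕ i)
... | true  | ofʸ i<j | true  | ofʸ j<i = ⊥-elim (<-asym i<j j<i)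
... | true  | _       | false | _       = sym (+-identityʳ _)
... | false | _       | true  | _       = cong [_] (Graph.sym G i j)
... | false | ofⁿ i≮j | false | ofⁿ j≮i with toℕ-injective (≤-antisym (≮⇒≥ j≮i) (≮⇒≥ i≮j))
...   | refl = cong [_] (irrefl G i)

∑∑-adj : ∀ {n} (G : Graph n) (h : Fin n → Fin n → ℕ) →
         ∑[ i < n ] ∑[ j < n ] ([ adj G i j ] * h i j) ≡ edgeSum G (λ i j → h i j + h j i)
∑∑-adj {n} G h = begin
  ∑[ i < n ] ∑[ j < n ] ([ adj G i j ] * h i j)
    ≡⟨ sum-cong-≗ (λ i → sum-cong-≗ λ j → split i j) ⟩
  ∑[ i < n ] ∑[ j < n ] (e i j * h i j + e j i * h i j)
    ≡⟨ ∑∑-distrib-+ (λ i j → e i j * h i j) (λ i j → e j i * h i j) ⟩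
  edgeSum G h + ∑[ i < n ] ∑[ j < n ] (e j i * h i j)
    ≡⟨ cong (edgeSum G h +_) (∑-comm (λ i j → e j i * h i j)) ⟩
  edgeSum G h + edgeSum G (λ i j → h j i)
    ≡⟨ ∑∑-distrib-+ (λ i j → e i j * h i j) (λ i j → e i j * h j i) ⟨
  ∑[ i < n ] ∑[ j < n ] (e i j * h i j + e i j * h j i)
    ≡⟨ sum-cong-≗ (λ i → sum-cong-≗ λ j → *-distribˡ-+ (e i j) (h i j) (h j i)) ⟨
  edgeSum G (λ i j → h i j + h j i) ∎
  where
  open ≡-Reasoning
  e : Fin n → Fin n → ℕ
  e = edgeInd G
  split : ∀ i j → [ adj G i j ] * h i j ≡ e i j * h i j + e j i * h i j
  split i j = trans (cong (_* h i j) (adj-split G i j)) (*-distribʳ-+ (h i j) (e i j) (e j i))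

edges≡edgeSum : ∀ {n} (G : Graph n) → edges G ≡ edgeSum G (λ _ _ → 1)
edges≡edgeSum G = trans (ΣᵥΣᵥ≡∑∑ (edgeInd G))
                        (sum-cong-≗ λ i → sum-cong-≗ λ j → sym (*-identityʳ (edgeInd G i j)))

eIn≡edgeSum : ∀ {n} (G : Graph n) (A : Subset n) → eIn G A ≡ edgeSum G (λ i j → [ A i ∧ A j ])
eIn≡edgeSum G A = trans (ΣᵥΣᵥ≡∑∑ λ i j → [ lt i j ∧ adj G i j ∧ A i ∧ A j ]) (sum-cong-≗ λ i → sum-cong-≗ λ j →
  trans (cong [_] (sym (∧-assoc (lt i j) (adj G i j) (A i ∧ A j))))
        ([∧] (lt i j ∧ adj G i j) (A i ∧ A j)))

vol≡edgeSum : ∀ {n} (G : Graph n) (A : Subset n) → vol G A ≡ edgeSum G (λ i j → [ A i ] + [ A j ])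
vol≡edgeSum {n} G A = begin
  vol G A                                         ≡⟨ Σᵥ≡∑ (λ i → if A i then deg G i else 0) ⟩
  ∑[ i < n ] (if A i then deg G i else 0)         ≡⟨ sum-cong-≗ row ⟩
  ∑[ i < n ] ∑[ j < n ] ([ adj G i j ] * [ A i ]) ≡⟨ ∑∑-adj G (λ i _ → [ A i ]) ⟩
  edgeSum G (λ i j → [ A i ] + [ A j ])           ∎
  where
  open ≡-Reasoning
  row : ∀ i → (if A i then deg G i else 0) ≡ ∑[ j < n ] ([ adj G i j ] * [ A i ])
  row i with A i
  ... | true  = trans (Σᵥ≡∑ λ j → [ adj G i j ]) (sum-cong-≗ λ j → sym (*-identityʳ [ adj G i j ]))
  ... | false = sym (∑-zero λ j → *-zeroʳ [ adj G i j ])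

edgeSum-congʳ : ∀ {n} (G : Graph n) {g h : Fin n → Fin n → ℕ} →
                (∀ i j → g i j ≡ h i j) → edgeSum G g ≡ edgeSum G h
edgeSum-congʳ G g≗h = sum-cong-≗ λ i → sum-cong-≗ λ j → cong (edgeInd G i j *_) (g≗h i j)

edgeSum-zero : ∀ {n} (G : Graph n) → edgeSum G (λ _ _ → 0) ≡ 0
edgeSum-zero G = ∑-zero λ i → ∑-zero λ j → *-zeroʳ (edgeInd G i j)

edgeSum-+ : ∀ {n} (G : Graph n) (g h : Fin n → Fin n → ℕ) →
            edgeSum G (λ i j → g i j + h i j) ≡ edgeSum G g + edgeSum G h
edgeSum-+ G g h = trans (sum-cong-≗ λ i → sum-cong-≗ λ j → *-distribˡ-+ (edgeInd G i j) (g i j) (h i j))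
                        (∑∑-distrib-+ (λ i j → edgeInd G i j * g i j) (λ i j → edgeInd G i j * h i j))

edgeSum-+₃ : ∀ {n} (G : Graph n) (f g h : Fin n → Fin n → ℕ) →
             edgeSum G (λ i j → f i j + g i j + h i j) ≡ edgeSum G f + edgeSum G g + edgeSum G h
edgeSum-+₃ G f g h = trans (edgeSum-+ G (λ i j → f i j + g i j) h) (cong (_+ edgeSum G h) (edgeSum-+ G f g))

infix 4 _≅_
_≅_ : ∀ {n} → Graph n → Graph n → Set
G ≅ H = ∀ i j → adj G i j ≡ adj H i j

edgeSum-cong : ∀ {n} (G H : Graph n) → G ≅ H → ∀ g → edgeSum G g ≡ edgeSum H g
edgeSum-cong G H G≅H g = sum-cong-≗ λ i → sum-cong-≗ λ j → cong (λ b → [ lt i j ∧ b ] * g i j) (G≅H i j)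

edges-cong : ∀ {n} (G H : Graph n) → G ≅ H → edges G ≡ edges H
edges-cong G H G≅H =
  trans (edges≡edgeSum G) (trans (edgeSum-cong G H G≅H (λ _ _ → 1)) (sym (edges≡edgeSum H)))

eIn-cong : ∀ {n} (G H : Graph n) → G ≅ H → ∀ A → eIn G A ≡ eIn H A
eIn-cong G H G≅H A = trans (eIn≡edgeSum G A) (trans (edgeSum-cong G H G≅H _) (sym (eIn≡edgeSum H A)))

vol-cong : ∀ {n} (G H : Graph n) → G ≅ H → ∀ A → vol G A ≡ vol H A
vol-cong G H G≅H A = trans (vol≡edgeSum G A) (trans (edgeSum-cong G H G≅H _) (sym (vol≡edgeSum H A)))

eIn-congʳ : ∀ {n} (G : Graph n) {A B : Subset n} → (∀ i → A i ≡ B i) → eIn G A ≡ eIn G B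
eIn-congʳ G {A} {B} A≗B = trans (eIn≡edgeSum G A)
  (trans (edgeSum-congʳ G λ i j → cong₂ (λ a b → [ a ∧ b ]) (A≗B i) (A≗B j)) (sym (eIn≡edgeSum G B)))

vol-congʳ : ∀ {n} (G : Graph n) {A B : Subset n} → (∀ i → A i ≡ B i) → vol G A ≡ vol G B
vol-congʳ G {A} {B} A≗B = trans (vol≡edgeSum G A)
  (trans (edgeSum-congʳ G λ i j → cong₂ (λ a b → [ a ] + [ b ]) (A≗B i) (A≗B j)) (sym (vol≡edgeSum G B)))

infixl 6 _⊕_
_⊕_ : ∀ {n} → Graph n → Graph n → Graph n
G ⊕ H = record
  { adj    = λ i j → adj G i j xor adj H i j
  ; sym    = λ i j → cong₂ _xor_ (Graph.sym G i j) (Graph.sym H i j)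
  ; irrefl = λ i → cong₂ _xor_ (irrefl G i) (irrefl H i)
  }

⊕-cancelˡ : ∀ {n} (G H : Graph n) → G ⊕ (G ⊕ H) ≅ H
⊕-cancelˡ G H i j = trans (sym (xor-assoc (adj G i j) (adj G i j) (adj H i j)))
                          (cong (_xor adj H i j) (xor-same (adj G i j)))

⊕-cancelʳ : ∀ {n} (G H : Graph n) → G ⊕ H ⊕ H ≅ G
⊕-cancelʳ G H i j = trans (xor-assoc (adj G i j) (adj H i j) (adj H i j))
                          (trans (cong (adj G i j xor_) (xor-same (adj H i j))) (xor-identityʳ (adj G i j)))

-- dist G H is definitionally edges (G ⊕ H).

dist-⊕ : ∀ {n} (G H : Graph n) → dist G (G ⊕ H) ≡ edges H
dist-⊕ G H = edges-cong (G ⊕ (G ⊕ H)) H (⊕-cancelˡ G H)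

dist-cong : ∀ {n} (G H H′ : Graph n) → H ≅ H′ → dist G H ≡ dist G H′
dist-cong G H H′ H≅H′ = edges-cong (G ⊕ H) (G ⊕ H′) λ i j → cong (adj G i j xor_) (H≅H′ i j)

edges≡0⇒empty : ∀ {n} (G : Graph n) → edges G ≡ 0 → ∀ i j → adj G i j ≡ false
edges≡0⇒empty G m≡0 i j =
  [b]≡0⇒b≡false (trans (adj-split G i j) (cong₂ _+_ (edgeInd≡0 i j) (edgeInd≡0 j i)))
  where
  edgeInd≡0 : ∀ i j → edgeInd G i j ≡ 0
  edgeInd≡0 i =
    ∑≡0⇒ (edgeInd G i) (∑≡0⇒ (λ i → sum (edgeInd G i)) (trans (sym (ΣᵥΣᵥ≡∑∑ (edgeInd G))) m≡0) i)
  [b]≡0⇒b≡false : ∀ {b} → [ b ] ≡ 0 → b ≡ false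
  [b]≡0⇒b≡false {false} _ = refl

dist≡0⇒≅ : ∀ {n} (G H : Graph n) → dist G H ≡ 0 → G ≅ H
dist≡0⇒≅ G H d≡0 i j = xor≡false⇒≡ (edges≡0⇒empty (G ⊕ H) d≡0 i j)
  where
  xor≡false⇒≡ : ∀ {a b} → a xor b ≡ false → a ≡ b
  xor≡false⇒≡ {false} {false} _ = refl
  xor≡false⇒≡ {true}  {true}  _ = refl

EdgeDisjoint : ∀ {n} → Graph n → Graph n → Set
EdgeDisjoint G H = ∀ i j → adj H i j ≡ true → adj G i j ≡ false

edgeSum-⊕ : ∀ {n} (G H : Graph n) → EdgeDisjoint G H → ∀ g → edgeSum (G ⊕ H) g ≡ edgeSum G g + edgeSum H g
edgeSum-⊕ G H disjoint g =
  trans (sum-cong-≗ λ i → sum-cong-≗ λ j →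
           trans (cong (_* g i j) (edgeInd-⊕ i j)) (*-distribʳ-+ (g i j) (edgeInd G i j) (edgeInd H i j)))
        (∑∑-distrib-+ (λ i j → edgeInd G i j * g i j) (λ i j → edgeInd H i j * g i j))
  where
  split : ∀ l x y → (y ≡ true → x ≡ false) → [ l ∧ (x xor y) ] ≡ [ l ∧ x ] + [ l ∧ y ]
  split false x     y     _ = refl
  split true  false false _ = refl
  split true  false true  _ = refl
  split true  true  false _ = refl
  split true  true  true  h with () ← h refl
  edgeInd-⊕ : ∀ i j → edgeInd (G ⊕ H) i j ≡ edgeInd G i j + edgeInd H i j
  edgeInd-⊕ i j = split (lt i j) (adj G i j) (adj H i j) (disjoint i j)

isPair : ∀ {n} → Fin n → Fin n → Fin n → Fin n → Bool
isPair u v i j = does (i ≟ u) ∧ does (j ≟ v)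

isPair⇒≡ : ∀ {n} (u v i j : Fin n) → isPair u v i j ≡ true → i ≡ u × j ≡ v
isPair⇒≡ u v i j eq with i ≟ u | j ≟ v
... | yes i≡u | yes j≡v = i≡u , j≡v

single : ∀ {n} {u v : Fin n} → toℕ u < toℕ v → Graph n
single {u = u} {v} u<v = record
  { adj    = λ i j → isPair u v i j ∨ isPair v u i j
  ; sym    = λ i j → trans (cong₂ _∨_ (∧-comm (does (i ≟ u)) _) (∧-comm (does (i ≟ v)) _))
                           (∨-comm (isPair v u j i) _)
  ; irrefl = λ i → cong₂ _∨_ (not-both i) (trans (∧-comm (does (i ≟ v)) _) (not-both i))
  }
  where
  not-both : ∀ i → isPair u v i i ≡ false
  not-both i with isPair u v i i in eq
  ... | false = refl
  ... | true with isPair⇒≡ u v i i eq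
  ...   | refl , refl = ⊥-elim (<-irrefl refl u<v)

module _ {n} {u v : Fin n} (u<v : toℕ u < toℕ v) where

  edgeInd-single : ∀ i j → edgeInd (single u<v) i j ≡ [ isPair u v i j ]
  edgeInd-single i j with isPair u v i j in eq
  ... | true with isPair⇒≡ u v i j eq
  ...   | refl , refl rewrite <ᵇ-true u<v = refl
  edgeInd-single i j | false with isPair v u i j in eq′
  ...   | false = cong [_] (∧-zeroʳ (lt i j))
  ...   | true with isPair⇒≡ v u i j eq′
  ...     | refl , refl rewrite <ᵇ-false {toℕ v} {toℕ u} (<⇒≤ u<v) = refl

  edgeSum-single : ∀ g → edgeSum (single u<v) g ≡ g u v
  edgeSum-single g = begin
    edgeSum (single u<v) g
      ≡⟨ sum-cong-≗ (λ i → sum-cong-≗ λ j → factor i j) ⟩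
    ∑[ i < n ] ∑[ j < n ] ([ does (i ≟ u) ] * ([ does (j ≟ v) ] * g i j))
      ≡⟨ sum-cong-≗ (λ i → sym (*-distribˡ-sum [ does (i ≟ u) ] (λ j → [ does (j ≟ v) ] * g i j))) ⟩
    ∑[ i < n ] ([ does (i ≟ u) ] * ∑[ j < n ] ([ does (j ≟ v) ] * g i j))
      ≡⟨ sum-cong-≗ (λ i → cong ([ does (i ≟ u) ] *_) (∑-point v (g i))) ⟩
    ∑[ i < n ] ([ does (i ≟ u) ] * g i v)
      ≡⟨ ∑-point u (λ i → g i v) ⟩
    g u v ∎
    where
    open ≡-Reasoning
    factor : ∀ i j → edgeInd (single u<v) i j * g i j ≡ [ does (i ≟ u) ] * ([ does (j ≟ v) ] * g i j)
    factor i j = trans (cong (_* g i j) (trans (edgeInd-single i j) ([∧] (does (i ≟ u)) (does (j ≟ v)))))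
                       (*-assoc [ does (i ≟ u) ] [ does (j ≟ v) ] (g i j))

  single-adj : ∀ (G : Graph n) i j → adj (single u<v) i j ≡ true → adj G i j ≡ adj G u v
  single-adj G i j eq with isPair u v i j in eq₁ | isPair v u i j in eq₂
  ... | true | _ with isPair⇒≡ u v i j eq₁
  ...   | refl , refl = refl
  single-adj G i j eq | false | true with isPair⇒≡ v u i j eq₂
  ...   | refl , refl = Graph.sym G v u

  single-uv : adj (single u<v) u v ≡ true
  single-uv = cong₂ (λ a b → (a ∧ b) ∨ isPair v u u v) (dec-true (u ≟ u) refl) (dec-true (v ≟ v) refl)

  module _ (G : Graph n) where

    private
      S : Graph n
      S = single u<v

    dist-single : dist G (G ⊕ S) ≡ 1
    dist-single = trans (dist-⊕ G S) (trans (edges≡edgeSum S) (edgeSum-single (λ _ _ → 1)))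

    edgeSum-add : adj G u v ≡ false → ∀ g → edgeSum (G ⊕ S) g ≡ edgeSum G g + g u v
    edgeSum-add uv∉G g = trans (edgeSum-⊕ G S (λ i j e → trans (single-adj G i j e) uv∉G) g)
                               (cong (edgeSum G g +_) (edgeSum-single g))

    ⊕-single-addition : adj G u v ≡ false → Addition G (G ⊕ S)
    ⊕-single-addition uv∉G i j ij∈G with adj S i j in e
    ... | false = trans (xor-identityʳ (adj G i j)) ij∈G
    ... | true with () ← trans (sym ij∈G) (trans (single-adj G i j e) uv∉G)

    ⊕-single-deletion : adj G u v ≡ true → Deletion G (G ⊕ S)
    ⊕-single-deletion uv∈G i j ij∈G′ with adj S i j in e
    ... | false = trans (sym (xor-identityʳ (adj G i j))) ij∈G′
    ... | true  = trans (single-adj G i j e) uv∈G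

  edgeSum-remove : ∀ G → adj G u v ≡ true → ∀ g → edgeSum G g ≡ edgeSum (G ⊕ single u<v) g + g u v
  edgeSum-remove G uv∈G g = trans (edgeSum-cong G (G ⊕ S ⊕ S) (λ i j → sym (⊕-cancelʳ G S i j)) g)
                                  (edgeSum-add (G ⊕ S) (cong₂ _xor_ uv∈G single-uv) g)
    where
    S : Graph n
    S = single u<v

module _ {n} {u v : Fin n} (u<v : toℕ u < toℕ v) (G : Graph n) (A : Subset n) where

  private
    H : Graph n
    H = G ⊕ single u<v

  remove-cut-edge : adj G u v ≡ true → A u ≡ true → A v ≡ false →
                    edges G ≡ edges H + 1 × eIn G A ≡ eIn H A × vol G A ≡ vol H A + 1
  remove-cut-edge uv∈G u∈A v∉A =
      trans (edges≡edgeSum G) (trans (remove (λ _ _ → 1)) (cong (_+ 1) (sym (edges≡edgeSum H))))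
    , trans (eIn≡edgeSum G A) (trans (remove (λ i j → [ A i ∧ A j ]))
        (trans (cong₂ _+_ (sym (eIn≡edgeSum H A)) (cong₂ (λ x y → [ x ∧ y ]) u∈A v∉A)) (+-identityʳ (eIn H A))))
    , trans (vol≡edgeSum G A) (trans (remove (λ i j → [ A i ] + [ A j ]))
        (cong₂ _+_ (sym (vol≡edgeSum H A)) (cong₂ (λ x y → [ x ] + [ y ]) u∈A v∉A)))
    where
    remove : ∀ g → edgeSum G g ≡ edgeSum H g + g u v
    remove = edgeSum-remove u<v G uv∈G

  add-inner-edge : adj G u v ≡ false → A u ≡ true → A v ≡ true →
                   edges H ≡ edges G + 1 × eIn H A ≡ eIn G A + 1 × vol H A ≡ vol G A + 2
  add-inner-edge uv∉G u∈A v∈A =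
      trans (edges≡edgeSum H) (trans (add (λ _ _ → 1)) (cong (_+ 1) (sym (edges≡edgeSum G))))
    , trans (eIn≡edgeSum H A) (trans (add (λ i j → [ A i ∧ A j ]))
        (cong₂ _+_ (sym (eIn≡edgeSum G A)) (cong₂ (λ x y → [ x ∧ y ]) u∈A v∈A)))
    , trans (vol≡edgeSum H A) (trans (add (λ i j → [ A i ] + [ A j ]))
        (cong₂ _+_ (sym (vol≡edgeSum G A)) (cong₂ (λ x y → [ x ] + [ y ]) u∈A v∈A)))
    where
    add : ∀ g → edgeSum H g ≡ edgeSum G g + g u v
    add = edgeSum-add u<v G uv∉G

-- Modularity

module _ where

  open import Data.Integer using (+_)
  import Data.Integer.Properties as ℤ
  open import Data.Rational using (0ℚ; _/_)
    renaming (_<_ to _<ℚ_; _+_ to _+ℚ_; _-_ to _-ℚ_; -_ to -ℚ_)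
  import Data.Rational.Properties as ℚ
  open import Data.Rational.Unnormalised using (ℚᵘ; mkℚᵘ; *<*)
  import Data.Rational.Unnormalised as ℚᵘ
  import Data.Rational.Unnormalised.Properties as ℚᵘ

  0<p-q⇔q<p : ∀ p q → 0ℚ <ℚ p -ℚ q ⇔ q <ℚ p
  0<p-q⇔q<p p q = mk⇔
    (λ 0<p-q → subst₂ _<ℚ_ (ℚ.+-identityˡ q) p-q+q≡p (ℚ.+-monoˡ-< q 0<p-q))
    (λ q<p → subst (_<ℚ p -ℚ q) (ℚ.+-inverseʳ q) (ℚ.+-monoˡ-< (-ℚ q) q<p))
    where
    p-q+q≡p : (p -ℚ q) +ℚ q ≡ p
    p-q+q≡p = trans (ℚ.+-assoc p (-ℚ q) q) (trans (cong (p +ℚ_) (ℚ.+-inverseˡ q)) (ℚ.+-identityʳ p))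

  fraction-<⇔ : ∀ a b k l → (+ a / suc k) <ℚ (+ b / suc l) ⇔ a * suc l < b * suc k
  fraction-<⇔ a b k l = mk⇔
    (λ lt → cross (ℚᵘ.<-respˡ-≃ (ℚ.toℚᵘ-fromℚᵘ a/k)
                    (ℚᵘ.<-respʳ-≃ (ℚ.toℚᵘ-fromℚᵘ b/l) (ℚ.toℚᵘ-mono-< lt))))
    (λ lt → ℚ.toℚᵘ-cancel-< (ℚᵘ.<-respˡ-≃ (ℚᵘ.≃-sym (ℚ.toℚᵘ-fromℚᵘ a/k))
                             (ℚᵘ.<-respʳ-≃ (ℚᵘ.≃-sym (ℚ.toℚᵘ-fromℚᵘ b/l)) (*<* (ℤ.+◃-mono-< lt)))))
    where
    a/k b/l : ℚᵘ
    a/k = mkℚᵘ (+ a) k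
    b/l = mkℚᵘ (+ b) l
    cross : a/k ℚᵘ.< b/l → a * suc l < b * suc k
    cross (*<* lt) = ℤ.+◃-cancel-< lt

  -- The instance argument of _/_ is irrelevant, so any proof of NonZero (4 * (m * m)) matches `score`.
  gap-pos⇔ : ∀ m .{{_ : NonZero m}} E V →
    0ℚ <ℚ (+ E / m) -ℚ (_/_ (+ V) (4 * (m * m)) {{m*n≢0 4 (m * m) {{_}} {{m*n≢0 m m}}}}) ⇔ V < 4 * m * E
  gap-pos⇔ (suc k) E V = mk⇔
    (λ pos → *-cancelʳ-< (suc k) V (4 * suc k * E) (subst (V * suc k <_) rearrange
               (Equivalence.to (fraction-<⇔ V E _ k) (Equivalence.to (0<p-q⇔q<p _ _) pos))))
    (λ V<4mE → Equivalence.from (0<p-q⇔q<p _ _) (Equivalence.from (fraction-<⇔ V E _ k)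
               (subst (V * suc k <_) (sym rearrange) (*-monoˡ-< (suc k) V<4mE))))
    where
    rearrange : E * (4 * (suc k * suc k)) ≡ 4 * suc k * E * suc k
    rearrange = solve (E ∷ k ∷ [])

  score-pos⇔ : ∀ {n} (G : Graph n) .{{_ : NonZero (edges G)}} (c : Partition n) →
               0ℚ <ℚ score G c
               ⇔ Σᵥ (λ k → vol G (part c k) * vol G (part c k)) < 4 * edges G * Σᵥ (λ k → eIn G (part c k))
  score-pos⇔ G c = gap-pos⇔ (edges G) _ _

-- A part A contributes e(A)/m − (vol A / 2m)² to a score; it is unclustered if this is ≤ 0.
Unclustered : ∀ {n} → Graph n → Subset n → Set
Unclustered G A = 4 * edges G * eIn G A ≤ vol G A * vol G A

unclustered⇒¬posMod : ∀ {n} (G : Graph n) → (∀ A → Unclustered G A) → ¬ PosMod G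
unclustered⇒¬posMod {n} G unclustered (nz , c , pos) =
  <⇒≱ (Equivalence.to (score-pos⇔ G {{nz}} c) pos) (begin
    4 * edges G * Σᵥ (λ k → eIn G (A k))          ≡⟨ cong (4 * edges G *_) (Σᵥ≡∑ λ k → eIn G (A k)) ⟩
    4 * edges G * ∑[ k < n ] eIn G (A k)           ≡⟨ *-distribˡ-sum (4 * edges G) (λ k → eIn G (A k)) ⟩
    ∑[ k < n ] (4 * edges G * eIn G (A k))         ≤⟨ ∑-mono-≤ (unclustered ∘ A) ⟩
    ∑[ k < n ] (vol G (A k) * vol G (A k))         ≡⟨ Σᵥ≡∑ (λ k → vol G (A k) * vol G (A k)) ⟨
    Σᵥ (λ k → vol G (A k) * vol G (A k))           ∎)
  where
  open ≤-Reasoning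
  A : Fin n → Subset n
  A = part c

unclustered-cong : ∀ {n} (G H : Graph n) → G ≅ H → ∀ {A} → Unclustered G A → Unclustered H A
unclustered-cong G H G≅H {A} =
  subst₂ (λ m e → 4 * m * e ≤ vol H A * vol H A) (edges-cong G H G≅H) (eIn-cong G H G≅H A)
  ∘ subst (λ v → 4 * edges G * eIn G A ≤ v * v) (vol-cong G H G≅H A)

unclustered-congʳ : ∀ {n} (G : Graph n) {A B : Subset n} →
                    (∀ i → A i ≡ B i) → Unclustered G A → Unclustered G B
unclustered-congʳ G A≗B = subst₂ (λ e v → 4 * edges G * e ≤ v * v) (eIn-congʳ G A≗B) (vol-congʳ G A≗B)

posMod⇒1≤dist : ∀ {n} (G H : Graph n) → (∀ A → Unclustered G A) → PosMod H → 1 ≤ dist G H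
posMod⇒1≤dist G H unclustered posMod = n≢0⇒n>0 λ d≡0 →
  unclustered⇒¬posMod H (λ A → unclustered-cong G H (dist≡0⇒≅ G H d≡0) (unclustered A)) posMod

module Bipartition {n} (G : Graph n) (A : Subset n) where

  Ā : Subset n
  Ā = not ∘ A

  cut : ℕ
  cut = edgeSum G (λ i j → [ A i xor A j ])

  edges≡ : edges G ≡ eIn G A + eIn G Ā + cut
  edges≡ = trans (edges≡edgeSum G) (trans (edgeSum-congʳ G λ i j → split (A i) (A j))
             (trans (edgeSum-+₃ G _ _ _) (sym (cong₂ (λ x y → x + y + cut) (eIn≡edgeSum G A) (eIn≡edgeSum G Ā)))))
    where
    split : ∀ a b → 1 ≡ [ a ∧ b ] + [ not a ∧ not b ] + [ a xor b ]
    split false false = refl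
    split false true  = refl
    split true  false = refl
    split true  true  = refl

  vol≡ : ∀ (B : Subset n) → (∀ i j → [ B i ] + [ B j ] ≡ [ B i ∧ B j ] + [ B i ∧ B j ] + [ A i xor A j ]) →
         vol G B ≡ eIn G B + eIn G B + cut
  vol≡ B split = trans (vol≡edgeSum G B) (trans (edgeSum-congʳ G split)
                   (trans (edgeSum-+₃ G _ _ _) (sym (cong (λ x → x + x + cut) (eIn≡edgeSum G B)))))

  volA≡ : vol G A ≡ eIn G A + eIn G A + cut
  volA≡ = vol≡ A λ i j → split (A i) (A j)
    where
    split : ∀ a b → [ a ] + [ b ] ≡ [ a ∧ b ] + [ a ∧ b ] + [ a xor b ]
    split false false = refl
    split false true  = refl
    split true  false = refl
    split true  true  = refl

  volĀ≡ : vol G Ā ≡ eIn G Ā + eIn G Ā + cut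
  volĀ≡ = vol≡ Ā λ i j → split (A i) (A j)
    where
    split : ∀ a b → [ not a ] + [ not b ] ≡ [ not a ∧ not b ] + [ not a ∧ not b ] + [ a xor b ]
    split false false = refl
    split false true  = refl
    split true  false = refl
    split true  true  = refl

-- With m = X + Y + C, both parts have the same contribution 4mX − (2X + C)² = 4XY − C² = 4mY − (2Y + C)².
bipartition-gap : ∀ X Y C → (X + X + C) * (X + X + C) < 4 * (X + Y + C) * X →
  (X + X + C) * (X + X + C) + (Y + Y + C) * (Y + Y + C) < 4 * (X + Y + C) * (X + Y)
bipartition-gap X Y C gapA = subst (VA² + VĀ² <_) (sym (*-distribˡ-+ (4 * m) X Y)) (+-mono-< gapA gapĀ)
  where
  m VA² VĀ² : ℕ
  m = X + Y + C
  VA² = (X + X + C) * (X + X + C)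
  VĀ² = (Y + Y + C) * (Y + Y + C)
  balance : ∀ X Y C → 4 * (X + Y + C) * X + (Y + Y + C) * (Y + Y + C)
                      ≡ (X + X + C) * (X + X + C) + 4 * (X + Y + C) * Y
  balance = solve-∀
  gapĀ : VĀ² < 4 * m * Y
  gapĀ = +-cancelˡ-< VA² VĀ² (4 * m * Y) (subst (VA² + VĀ² <_) (balance X Y C) (+-monoˡ-< VĀ² gapA))

clustered⇒posMod : ∀ {n} (G : Graph n) (A : Subset n) → vol G A * vol G A < 4 * edges G * eIn G A → PosMod G
clustered⇒posMod {zero}        G A ()
clustered⇒posMod {suc zero}    G A ()
clustered⇒posMod {suc (suc n)} G A gap = nz , c , Equivalence.from (score-pos⇔ G {{nz}} c) (begin-strict
  Σᵥ (λ k → vol G (part c k) * vol G (part c k))  ≡⟨ Σᵥ-parts (λ B → vol G B * vol G B) vol²-cong vol∅ ⟩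
  vol G A * vol G A + vol G Ā * vol G Ā          ≡⟨ cong₂ (λ x y → x * x + y * y) volA≡ volĀ≡ ⟩
  (X + X + cut) * (X + X + cut) + (Y + Y + cut) * (Y + Y + cut)
    <⟨ bipartition-gap X Y cut (subst₂ (λ v m → v * v < 4 * m * X) volA≡ edges≡ gap) ⟩
  4 * (X + Y + cut) * (X + Y)
    ≡⟨ cong₂ (λ m e → 4 * m * e) edges≡ (Σᵥ-parts (eIn G) (eIn-congʳ G) eIn∅) ⟨
  4 * edges G * Σᵥ (λ k → eIn G (part c k))      ∎)
  where
  open Bipartition G A
  open ≤-Reasoning
  X Y : ℕ
  X = eIn G A
  Y = eIn G Ā
  nz : NonZero (edges G)
  nz = nonZero gap
    where
    nonZero : ∀ {m x y} → x < 4 * m * y → NonZero m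
    nonZero {suc m} _ = _
  c : Partition (suc (suc n))
  c v = if A v then zero else suc zero
  eIn∅ : eIn G (λ _ → false) ≡ 0
  eIn∅ = trans (eIn≡edgeSum G (λ _ → false)) (edgeSum-zero G)
  vol∅ : vol G (λ _ → false) * vol G (λ _ → false) ≡ 0
  vol∅ = cong (λ v → v * v) (trans (vol≡edgeSum G (λ _ → false)) (edgeSum-zero G))
  vol²-cong : ∀ {B B′} → (∀ i → B i ≡ B′ i) → vol G B * vol G B ≡ vol G B′ * vol G B′
  vol²-cong B≗B′ = cong (λ v → v * v) (vol-congʳ G B≗B′)
  Σᵥ-parts : (f : Subset (suc (suc n)) → ℕ) → (∀ {B B′} → (∀ i → B i ≡ B′ i) → f B ≡ f B′) →
             f (λ _ → false) ≡ 0 → Σᵥ (λ k → f (part c k)) ≡ f A + f Ā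
  Σᵥ-parts f f-cong f∅≡0 = trans (Σᵥ≡∑ λ k → f (part c k))
    (cong₂ _+_ (f-cong part₀)
               (trans (cong₂ _+_ (f-cong part₁) (∑-zero λ k → trans (f-cong (part₂ k)) f∅≡0)) (+-identityʳ (f Ā))))
    where
    part₀ : ∀ v → part c zero v ≡ A v
    part₀ v with A v
    ... | true  = refl
    ... | false = refl
    part₁ : ∀ v → part c (suc zero) v ≡ Ā v
    part₁ v with A v
    ... | true  = refl
    ... | false = refl
    part₂ : ∀ k v → part c (suc (suc k)) v ≡ false
    part₂ k v with A v
    ... | true  = refl
    ... | false = refl

am-gm-≤ : ∀ {x y} → x ≤ y → 4 * (x * y) ≤ (x + y) * (x + y)
am-gm-≤ {x} x≤y with m≤n⇒∃[o]m+o≡n x≤y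
... | d , refl = subst (4 * (x * (x + d)) ≤_) (square x d) (m≤m+n _ (d * d))
  where
  square : ∀ x d → 4 * (x * (x + d)) + d * d ≡ (x + (x + d)) * (x + (x + d))
  square = solve-∀

am-gm : ∀ x y → 4 * (x * y) ≤ (x + y) * (x + y)
am-gm x y with ≤-total x y
... | inj₁ x≤y = am-gm-≤ x≤y
... | inj₂ y≤x = subst₂ (λ p q → 4 * p ≤ q * q) (*-comm y x) (+-comm y x) (am-gm-≤ y≤x)

bipartite-counts⇒unclustered : ∀ {n} (G : Graph n) (A : Subset n) {s t a b} →
  edges G ≡ s * t → eIn G A ≡ a * b → vol G A ≡ t * a + s * b → Unclustered G A
bipartite-counts⇒unclustered G A {s} {t} {a} {b} m≡st e≡ab v≡ta+sb =
  subst₂ _≤_ (trans (rearrange s t a b) (sym (cong₂ (λ m e → 4 * m * e) m≡st e≡ab)))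
             (sym (cong (λ v → v * v) v≡ta+sb))
             (am-gm (t * a) (s * b))
  where
  rearrange : ∀ s t a b → 4 * (t * a * (s * b)) ≡ 4 * (s * t) * (a * b)
  rearrange = solve-∀

-- Complete bipartite graphs and stars

module _ {s t : ℕ} where

  ↑ˡ<s : ∀ (i : Fin s) → toℕ (i ↑ˡ t) < s
  ↑ˡ<s i = subst (_< s) (sym (toℕ-↑ˡ i t)) (toℕ<n i)

  s≤↑ʳ : ∀ (j : Fin t) → s ≤ toℕ (s ↑ʳ j)
  s≤↑ʳ j = subst (s ≤_) (sym (toℕ-↑ʳ s j)) (m≤m+n s (toℕ j))

  ↑ˡ<↑ʳ : ∀ (i : Fin s) (j : Fin t) → toℕ (i ↑ˡ t) < toℕ (s ↑ʳ j)
  ↑ˡ<↑ʳ i j = <-≤-trans (↑ˡ<s i) (s≤↑ʳ j)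

  K-adj-↑ˡ↑ʳ : ∀ i j → adj (K s t) (i ↑ˡ t) (s ↑ʳ j) ≡ true
  K-adj-↑ˡ↑ʳ i j = cong₂ _xor_ (<ᵇ-true (↑ˡ<s i)) (<ᵇ-false (s≤↑ʳ j))

  K-adj-↑ʳ↑ʳ : ∀ j j′ → adj (K s t) (s ↑ʳ j) (s ↑ʳ j′) ≡ false
  K-adj-↑ʳ↑ʳ j j′ = cong₂ _xor_ (<ᵇ-false (s≤↑ʳ j)) (<ᵇ-false (s≤↑ʳ j′))

  edgeSum-K : ∀ g → edgeSum (K s t) g ≡ ∑[ i < s ] ∑[ j < t ] g (i ↑ˡ t) (s ↑ʳ j)
  edgeSum-K g = begin
    ∑[ x < s + t ] row x
      ≡⟨ ∑-↑ s row ⟩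
    ∑[ i < s ] row (i ↑ˡ t) + ∑[ j < t ] row (s ↑ʳ j)
      ≡⟨ cong₂ _+_ (sum-cong-≗ λ i → ∑-↑ s (term (i ↑ˡ t))) (∑-zero λ j → ∑-zero (right-right j)) ⟩
    ∑[ i < s ] (∑[ i′ < s ] term (i ↑ˡ t) (i′ ↑ˡ t) + ∑[ j < t ] term (i ↑ˡ t) (s ↑ʳ j)) + 0
      ≡⟨ trans (+-identityʳ _) (sum-cong-≗ λ i → cong₂ _+_ (∑-zero (left-left i)) (sum-cong-≗ (left-right i))) ⟩
    ∑[ i < s ] ∑[ j < t ] g (i ↑ˡ t) (s ↑ʳ j) ∎
    where
    open ≡-Reasoning
    term : Fin (s + t) → Fin (s + t) → ℕ
    term x y = edgeInd (K s t) x y * g x y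
    row : Fin (s + t) → ℕ
    row x = ∑[ y < s + t ] term x y
    left-left : ∀ i i′ → term (i ↑ˡ t) (i′ ↑ˡ t) ≡ 0
    left-left i i′ rewrite <ᵇ-true (↑ˡ<s i) | <ᵇ-true (↑ˡ<s i′) | ∧-zeroʳ (lt (i ↑ˡ t) (i′ ↑ˡ t)) = refl
    left-right : ∀ i j → term (i ↑ˡ t) (s ↑ʳ j) ≡ g (i ↑ˡ t) (s ↑ʳ j)
    left-right i j rewrite K-adj-↑ˡ↑ʳ i j | <ᵇ-true (↑ˡ<↑ʳ i j) = +-identityʳ _
    right-right : ∀ j y → term (s ↑ʳ j) y ≡ 0
    right-right j y with toℕ y <ᵇ s | <ᵇ-reflects-< (toℕ y) s
    ... | false | _       rewrite <ᵇ-false (s≤↑ʳ j) | ∧-zeroʳ (lt (s ↑ʳ j) y) = refl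
    ... | true  | ofʸ y<s rewrite <ᵇ-false (<⇒≤ (<-≤-trans y<s (s≤↑ʳ j))) = refl

  leftCount rightCount : Subset (s + t) → ℕ
  leftCount  A = ∑[ i < s ] [ A (i ↑ˡ t) ]
  rightCount A = ∑[ j < t ] [ A (s ↑ʳ j) ]

  edges-K : edges (K s t) ≡ s * t
  edges-K = begin
    edges (K s t)                ≡⟨ edges≡edgeSum (K s t) ⟩
    edgeSum (K s t) (λ _ _ → 1)  ≡⟨ edgeSum-K (λ _ _ → 1) ⟩
    ∑[ i < s ] ∑[ j < t ] 1      ≡⟨ trans (sum-cong-≗ {s} λ _ → ∑-const t 1) (∑-const s (t * 1)) ⟩
    s * (t * 1)                  ≡⟨ cong (s *_) (*-identityʳ t) ⟩
    s * t                        ∎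
    where open ≡-Reasoning

  eIn-K : ∀ A → eIn (K s t) A ≡ leftCount A * rightCount A
  eIn-K A = begin
    eIn (K s t) A
      ≡⟨ eIn≡edgeSum (K s t) A ⟩
    edgeSum (K s t) (λ x y → [ A x ∧ A y ])
      ≡⟨ edgeSum-K (λ x y → [ A x ∧ A y ]) ⟩
    ∑[ i < s ] ∑[ j < t ] [ A (i ↑ˡ t) ∧ A (s ↑ʳ j) ]
      ≡⟨ sum-cong-≗ (λ i → sum-cong-≗ λ j → [∧] (A (i ↑ˡ t)) (A (s ↑ʳ j))) ⟩
    ∑[ i < s ] ∑[ j < t ] ([ A (i ↑ˡ t) ] * [ A (s ↑ʳ j) ])
      ≡⟨ ∑∑-product (λ i → [ A (i ↑ˡ t) ]) (λ j → [ A (s ↑ʳ j) ]) ⟩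
    leftCount A * rightCount A ∎
    where open ≡-Reasoning

  vol-K : ∀ A → vol (K s t) A ≡ t * leftCount A + s * rightCount A
  vol-K A = begin
    vol (K s t) A
      ≡⟨ vol≡edgeSum (K s t) A ⟩
    edgeSum (K s t) (λ x y → [ A x ] + [ A y ])
      ≡⟨ edgeSum-K (λ x y → [ A x ] + [ A y ]) ⟩
    ∑[ i < s ] ∑[ j < t ] ([ A (i ↑ˡ t) ] + [ A (s ↑ʳ j) ])
      ≡⟨ ∑∑-distrib-+ (λ i _ → [ A (i ↑ˡ t) ]) (λ _ j → [ A (s ↑ʳ j) ]) ⟩
    ∑[ i < s ] ∑[ j < t ] [ A (i ↑ˡ t) ] + ∑[ i < s ] rightCount A
      ≡⟨ cong₂ _+_ (trans (sum-cong-≗ λ i → ∑-const t [ A (i ↑ˡ t) ])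
                          (sym (*-distribˡ-sum t λ i → [ A (i ↑ˡ t) ])))
                   (∑-const s (rightCount A)) ⟩
    t * leftCount A + s * rightCount A ∎
    where open ≡-Reasoning

K-unclustered : ∀ s t A → Unclustered (K s t) A
K-unclustered s t A =
  bipartite-counts⇒unclustered (K s t) A {s} {t} (edges-K {s} {t}) (eIn-K {s} {t} A) (vol-K {s} {t} A)

block : ∀ s {t} → ℕ → ℕ → Subset (s + t)
block s a b = [ (λ i → toℕ i <ᵇ a) , (λ j → toℕ j <ᵇ b) ]′ ∘ splitAt s

module _ {s t : ℕ} (a b : ℕ) where

  private
    A : Subset (s + t)
    A = block s a b

  block-↑ˡ : ∀ i → block s {t} a b (i ↑ˡ t) ≡ (toℕ i <ᵇ a)
  block-↑ˡ i = cong [ _ , _ ]′ (splitAt-↑ˡ s i t)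

  block-↑ʳ : ∀ j → block s {t} a b (s ↑ʳ j) ≡ (toℕ j <ᵇ b)
  block-↑ʳ j = cong [ _ , _ ]′ (splitAt-↑ʳ s t j)

  leftCount-block : a ≤ s → leftCount {s} {t} A ≡ a
  leftCount-block a≤s = trans (sum-cong-≗ λ i → cong [_] (block-↑ˡ i)) (∑-count a≤s)

  rightCount-block : b ≤ t → rightCount {s} {t} A ≡ b
  rightCount-block b≤t = trans (sum-cong-≗ λ j → cong [_] (block-↑ʳ j)) (∑-count b≤t)

  eIn-block : a ≤ s → b ≤ t → eIn (K s t) A ≡ a * b
  eIn-block a≤s b≤t = trans (eIn-K {s} {t} A) (cong₂ _*_ (leftCount-block a≤s) (rightCount-block b≤t))

  vol-block : a ≤ s → b ≤ t → vol (K s t) A ≡ t * a + s * b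
  vol-block a≤s b≤t =
    trans (vol-K {s} {t} A) (cong₂ (λ x y → t * x + s * y) (leftCount-block a≤s) (rightCount-block b≤t))

module _ {t} (G : Graph (suc t)) (leaves-independent : ∀ i j → adj G (suc i) (suc j) ≡ false) where

  private
    L : Fin t → Bool
    L j = adj G zero (suc j)

  edgeSum-star : ∀ g → edgeSum G g ≡ ∑[ j < t ] ([ L j ] * g zero (suc j))
  edgeSum-star g = trans (cong (∑[ j < t ] ([ L j ] * g zero (suc j)) +_) (∑-zero λ i → ∑-zero (leaf-leaf i)))
                         (+-identityʳ _)
    where
    leaf-leaf : ∀ i j → edgeInd G (suc i) (suc j) * g (suc i) (suc j) ≡ 0
    leaf-leaf i j rewrite leaves-independent i j | ∧-zeroʳ (lt (suc i) (suc j)) = refl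

  star-unclustered : ∀ A → Unclustered G A
  star-unclustered A = bipartite-counts⇒unclustered G A {1} {k} {[ A zero ]} {ℓ} edges≡ eIn≡ vol≡
    where
    k ℓ : ℕ
    k = ∑[ j < t ] [ L j ]
    ℓ = ∑[ j < t ] [ L j ∧ A (suc j) ]
    edges≡ : edges G ≡ 1 * k
    edges≡ = trans (edges≡edgeSum G) (trans (edgeSum-star λ _ _ → 1)
               (trans (sum-cong-≗ λ j → *-identityʳ [ L j ]) (sym (+-identityʳ k))))
    eIn≡ : eIn G A ≡ [ A zero ] * ℓ
    eIn≡ = trans (eIn≡edgeSum G A) (trans (edgeSum-star λ i j → [ A i ∧ A j ])
             (trans (sum-cong-≗ λ j → centre-edge (A zero) (L j) (A (suc j)))
                    (sym (*-distribˡ-sum [ A zero ] λ j → [ L j ∧ A (suc j) ]))))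
      where
      centre-edge : ∀ a l x → [ l ] * [ a ∧ x ] ≡ [ a ] * [ l ∧ x ]
      centre-edge false l     x = *-zeroʳ [ l ]
      centre-edge true  false x = refl
      centre-edge true  true  x = refl
    vol≡ : vol G A ≡ k * [ A zero ] + 1 * ℓ
    vol≡ = trans (vol≡edgeSum G A) (trans (edgeSum-star λ i j → [ A i ] + [ A j ])
             (trans (sum-cong-≗ λ j → centre-vol (A zero) (L j) (A (suc j)))
               (trans (∑-distrib-+ (λ j → [ L j ] * [ A zero ]) (λ j → [ L j ∧ A (suc j) ]))
                      (cong₂ _+_ (sym (*-distribʳ-sum [ A zero ] λ j → [ L j ])) (sym (+-identityʳ ℓ))))))
      where
      centre-vol : ∀ a l x → [ l ] * ([ a ] + [ x ]) ≡ [ l ] * [ a ] + [ l ∧ x ]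
      centre-vol a     false x = refl
      centre-vol false true  x = +-identityʳ [ x ]
      centre-vol true  true  x = cong suc (+-identityʳ [ x ])

star-deletion-¬posMod : ∀ {t} (H : Graph (1 + t)) → Deletion (K 1 t) H → ¬ PosMod H
star-deletion-¬posMod H H⊆K = unclustered⇒¬posMod H (star-unclustered H leaves-independent)
  where
  leaves-independent : ∀ i j → adj H (suc i) (suc j) ≡ false
  leaves-independent i j = ¬-not λ ij∈H → case H⊆K (suc i) (suc j) ij∈H of λ ()

-- Balanced splits

-- The sizes of a set with a left and b right vertices in K_{s,t}, where s = a + c, t = b + w and
-- ta − sb = r ∈ [0, s): the two AM–GM terms ta and sb of its volume nearly agree.
record BalancedSplit (s t : ℕ) : Set where
  field
    a c b w r : ℕ
    s≡a+c     : s ≡ a + c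
    t≡b+w     : t ≡ b + w
    ta≡r+sb   : t * a ≡ r + s * b
    r<s       : r < s
    c≤a       : c ≤ a
    a≤1+c     : a ≤ suc c
    1≤c       : 1 ≤ c

⌈n/2⌉≤1+⌊n/2⌋ : ∀ n → ⌈ n /2⌉ ≤ suc ⌊ n /2⌋
⌈n/2⌉≤1+⌊n/2⌋ zero          = z≤n
⌈n/2⌉≤1+⌊n/2⌋ (suc zero)    = s≤s z≤n
⌈n/2⌉≤1+⌊n/2⌋ (suc (suc n)) = s≤s (⌈n/2⌉≤1+⌊n/2⌋ n)

balancedSplit : ∀ {s t} → 2 ≤ s → BalancedSplit s t
balancedSplit {s@(suc _)} {t} 2≤s = record
  { a = a ; c = ⌊ s /2⌋ ; b = b ; w = t ∸ b ; r = r
  ; s≡a+c   = trans (sym (⌊n/2⌋+⌈n/2⌉≡n s)) (+-comm ⌊ s /2⌋ a)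
  ; t≡b+w   = sym (m+[n∸m]≡n b≤t)
  ; ta≡r+sb = trans ta≡r+bs (cong (r +_) (*-comm b s))
  ; r<s     = m%n<n (t * a) s
  ; c≤a     = ⌊n/2⌋≤⌈n/2⌉ s
  ; a≤1+c   = ⌈n/2⌉≤1+⌊n/2⌋ s
  ; 1≤c     = ⌊n/2⌋-mono 2≤s
  }
  where
  a b r : ℕ
  a = ⌈ s /2⌉
  b = t * a ℕ./ s
  r = t * a ℕ.% s
  ta≡r+bs : t * a ≡ r + b * s
  ta≡r+bs = m≡m%n+[m/n]*n (t * a) s
  b≤t : b ≤ t
  b≤t = *-cancelʳ-≤ b t s (begin
    b * s      ≤⟨ m≤n+m (b * s) r ⟩
    r + b * s  ≡⟨ ta≡r+bs ⟨
    t * a      ≤⟨ *-monoʳ-≤ t (⌈n/2⌉≤n s) ⟩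
    t * s      ∎)
    where open ≤-Reasoning

<a+c⇒≤c+c : ∀ {a c r} → r < a + c → a ≤ suc c → r ≤ c + c
<a+c⇒≤c+c {a} {c} r<a+c a≤1+c = s≤s⁻¹ (<-≤-trans r<a+c (+-monoˡ-≤ c a≤1+c))

-- (r − 1)² < 4cb, stated without truncated subtraction.
deletion-slack : ∀ {a c b r} → r < a + c → a ≤ suc c → 1 ≤ c → c ≤ b → r * r + 1 < 2 * r + 4 * (c * b)
deletion-slack {r = zero} _ _ 1≤c c≤b =
  ≤-trans (s≤s (s≤s z≤n)) (*-monoʳ-≤ 4 (*-mono-≤ 1≤c (≤-trans 1≤c c≤b)))
deletion-slack {a} {c} {b} {suc r} r<a+c a≤1+c 1≤c c≤b = begin-strict
  suc r * suc r + 1        ≡⟨ expand r ⟩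
  r * r + 2 * suc r        <⟨ +-monoˡ-< (2 * suc r) r²<4cb ⟩
  4 * (c * b) + 2 * suc r  ≡⟨ +-comm (4 * (c * b)) (2 * suc r) ⟩
  2 * suc r + 4 * (c * b)  ∎
  where
  open ≤-Reasoning
  r<c+c : r < c + c
  r<c+c = <a+c⇒≤c+c r<a+c a≤1+c
  expand : ∀ r → suc r * suc r + 1 ≡ r * r + 2 * suc r
  expand = solve-∀
  double-square : ∀ c → (c + c) * (c + c) ≡ 4 * (c * c)
  double-square = solve-∀
  r²<4cb : r * r < 4 * (c * b)
  r²<4cb = begin-strict
    r * r              <⟨ *-mono-< r<c+c r<c+c ⟩
    (c + c) * (c + c)  ≡⟨ double-square c ⟩
    4 * (c * c)        ≤⟨ *-monoʳ-≤ 4 (*-monoʳ-≤ c c≤b) ⟩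
    4 * (c * b)        ∎

addition-slack : ∀ {a c b w r} → r < a + c → a ≤ suc c → 1 ≤ c → a + c ≤ b + w →
                 (a + c) * w ≡ (b + w) * c + r → r * r < 4 * (c * w)
addition-slack {a} {c} {b} {w} {r} r<s a≤1+c 1≤c s≤t sw≡tc+r = begin-strict
  r * r              ≤⟨ *-monoˡ-≤ r (<a+c⇒≤c+c r<s a≤1+c) ⟩
  (c + c) * r        <⟨ *-monoʳ-< (c + c) {{>-nonZero (≤-trans 1≤c (m≤m+n c c))}} r<w+w ⟩
  (c + c) * (w + w)  ≡⟨ double-product c w ⟩
  4 * (c * w)        ∎
  where
  open ≤-Reasoning
  double-product : ∀ c w → (c + c) * (w + w) ≡ 4 * (c * w)
  double-product = solve-∀
  t : ℕ
  t = b + w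
  cr<ct : c * r < c * t
  cr<ct = *-monoʳ-< c {{>-nonZero 1≤c}} (<-≤-trans r<s s≤t)
  regroup : ∀ c r → (suc c + c) * r ≡ c * r + c * r + r
  regroup = solve-∀
  regroup′ : ∀ c t r → c * t + c * t + (r + r) ≡ 2 * (t * c + r)
  regroup′ = solve-∀
  regroup″ : ∀ a c w → 2 * ((a + c) * w) ≡ (a + c) * (w + w)
  regroup″ = solve-∀
  r<w+w : r < w + w
  r<w+w = *-cancelˡ-< (a + c) r (w + w) (begin-strict
    (a + c) * r              ≤⟨ *-monoˡ-≤ r (+-monoˡ-≤ c a≤1+c) ⟩
    (suc c + c) * r          ≡⟨ regroup c r ⟩
    c * r + c * r + r        <⟨ +-mono-<-≤ (+-mono-< cr<ct cr<ct) (m≤m+n r r) ⟩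
    c * t + c * t + (r + r)  ≡⟨ regroup′ c t r ⟩
    2 * (t * c + r)          ≡⟨ cong (2 *_) sw≡tc+r ⟨
    2 * ((a + c) * w)        ≡⟨ regroup″ a c w ⟩
    (a + c) * (w + w)        ∎)

balanced-square : ∀ P Q r → P ≡ r + Q → (P + Q) * (P + Q) ≡ 4 * P * Q + r * r
balanced-square _ Q r refl = square r Q
  where
  square : ∀ r Q → (r + Q + Q) * (r + Q + Q) ≡ 4 * (r + Q) * Q + r * r
  square = solve-∀

module _ {s t : ℕ} (B : BalancedSplit s t) (s≤t : s ≤ t) where

  open BalancedSplit B

  private
    a<s : a < s
    a<s = subst (a <_) (sym s≡a+c) (m<m+n a 1≤c)

  b<t : b < t
  b<t = *-cancelʳ-< s b t (begin-strict
    b * s      ≤⟨ m≤n+m (b * s) r ⟩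
    r + b * s  ≡⟨ cong (r +_) (*-comm b s) ⟩
    r + s * b  ≡⟨ ta≡r+sb ⟨
    t * a      <⟨ *-monoʳ-< t {{>-nonZero (<-≤-trans (≤-<-trans z≤n a<s) s≤t)}} a<s ⟩
    t * s      ∎)
    where open ≤-Reasoning

  c≤b : c ≤ b
  c≤b = s≤s⁻¹ (*-cancelˡ-< s c (suc b) (begin-strict
    s * c      ≤⟨ *-monoʳ-≤ s c≤a ⟩
    s * a      ≤⟨ *-monoˡ-≤ a s≤t ⟩
    t * a      ≡⟨ ta≡r+sb ⟩
    r + s * b  <⟨ +-monoˡ-< (s * b) r<s ⟩
    s + s * b  ≡⟨ *-suc s b ⟨
    s * suc b  ∎))
    where open ≤-Reasoning

  2≤b : 4 ≤ t → 2 ≤ b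
  2≤b 4≤t = *-cancelˡ-< s 1 b (+-cancelˡ-< s (s * 1) (s * b) (begin-strict
    s + s * 1        ≡⟨ cong (s +_) (*-identityʳ s) ⟩
    s + s            ≤⟨ +-mono-≤ s≤a+a s≤a+a ⟩
    a + a + (a + a)  ≡⟨ four-times a ⟩
    4 * a            ≤⟨ *-monoˡ-≤ a 4≤t ⟩
    t * a            ≡⟨ ta≡r+sb ⟩
    r + s * b        <⟨ +-monoˡ-< (s * b) r<s ⟩
    s + s * b        ∎))
    where
    open ≤-Reasoning
    s≤a+a : s ≤ a + a
    s≤a+a = subst (_≤ a + a) (sym s≡a+c) (+-monoʳ-≤ a c≤a)
    four-times : ∀ a → a + a + (a + a) ≡ 4 * a
    four-times = solve-∀

  sw≡tc+r : s * w ≡ t * c + r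
  sw≡tc+r = +-cancelˡ-≡ (s * b) (s * w) (t * c + r) (begin
    s * b + s * w        ≡⟨ *-distribˡ-+ s b w ⟨
    s * (b + w)          ≡⟨ cong (s *_) t≡b+w ⟨
    s * t                ≡⟨ *-comm s t ⟩
    t * s                ≡⟨ cong (t *_) s≡a+c ⟩
    t * (a + c)          ≡⟨ *-distribˡ-+ t a c ⟩
    t * a + t * c        ≡⟨ cong (_+ t * c) ta≡r+sb ⟩
    r + s * b + t * c    ≡⟨ rotate r (s * b) (t * c) ⟩
    s * b + (t * c + r)  ∎)
    where
    open ≡-Reasoning
    rotate : ∀ x y z → x + y + z ≡ y + (z + x)
    rotate = solve-∀

  -- After deleting an edge: 4mE − V² = 4cb − (r − 1)², in the form V² + (2r + 4cb) = 4mE + (r² + 1).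
  deletion-gap : ∀ {m V} → m + 1 ≡ s * t → V + 1 ≡ t * a + s * b → V * V < 4 * m * (a * b)
  deletion-gap {m} {V} m+1≡st V+1≡P+Q = +-cancelʳ-< (2 * (V + 1) + 4 * E) (V * V) (4 * m * E) (begin-strict
    V * V + (2 * (V + 1) + 4 * E)        ≡⟨ expand-pred V E ⟩
    (V + 1) * (V + 1) + 1 + 4 * E        ≡⟨ cong (λ x → x * x + 1 + 4 * E) V+1≡P+Q ⟩
    (P + Q) * (P + Q) + 1 + 4 * E        ≡⟨ cong (λ x → x + 1 + 4 * E) (balanced-square P Q r ta≡r+sb) ⟩
    4 * P * Q + r * r + 1 + 4 * E        ≡⟨ regroup t a s b r ⟩
    4 * (s * t) * E + (r * r + 1 + 4 * E)
      <⟨ +-monoʳ-< (4 * (s * t) * E) (+-monoˡ-< (4 * E) slack) ⟩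
    4 * (s * t) * E + (2 * r + 4 * (c * b) + 4 * E)
      ≡⟨ cong (4 * (s * t) * E +_) twice-vol ⟩
    4 * (s * t) * E + 2 * (P + Q)        ≡⟨ cong₂ (λ x y → 4 * x * E + 2 * y) m+1≡st V+1≡P+Q ⟨
    4 * (m + 1) * E + 2 * (V + 1)        ≡⟨ expand-pred′ m V E ⟩
    4 * m * E + (2 * (V + 1) + 4 * E)    ∎)
    where
    open ≤-Reasoning
    P Q E : ℕ
    P = t * a
    Q = s * b
    E = a * b
    slack : r * r + 1 < 2 * r + 4 * (c * b)
    slack = deletion-slack (subst (r <_) s≡a+c r<s) a≤1+c 1≤c c≤b
    regroup′ : ∀ r a c b → 2 * r + 4 * (c * b) + 4 * (a * b) ≡ 2 * (r + (a + c) * b + (a + c) * b)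
    regroup′ = solve-∀
    twice-vol : 2 * r + 4 * (c * b) + 4 * E ≡ 2 * (P + Q)
    twice-vol = begin-equality
      2 * r + 4 * (c * b) + 4 * (a * b)    ≡⟨ regroup′ r a c b ⟩
      2 * (r + (a + c) * b + (a + c) * b)  ≡⟨ cong (λ x → 2 * (r + x * b + x * b)) s≡a+c ⟨
      2 * (r + s * b + s * b)              ≡⟨ cong (λ x → 2 * (x + s * b)) ta≡r+sb ⟨
      2 * (t * a + s * b)                  ∎
    expand-pred : ∀ V E → V * V + (2 * (V + 1) + 4 * E) ≡ (V + 1) * (V + 1) + 1 + 4 * E
    expand-pred = solve-∀
    expand-pred′ : ∀ m V E → 4 * (m + 1) * E + 2 * (V + 1) ≡ 4 * m * E + (2 * (V + 1) + 4 * E)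
    expand-pred′ = solve-∀
    regroup : ∀ t a s b r → 4 * (t * a) * (s * b) + r * r + 1 + 4 * (a * b)
                            ≡ 4 * (s * t) * (a * b) + (r * r + 1 + 4 * (a * b))
    regroup = solve-∀

  -- After adding an edge: 4(st + 1)(ab + 1) − (ta + sb + 2)² = 4cw − r².
  addition-gap : (t * a + s * b + 2) * (t * a + s * b + 2) < 4 * (s * t + 1) * (a * b + 1)
  addition-gap = begin-strict
    (P + Q + 2) * (P + Q + 2)                    ≡⟨ expand-succ P Q ⟩
    (P + Q) * (P + Q) + (4 * (P + Q) + 4)        ≡⟨ cong (_+ (4 * (P + Q) + 4)) (balanced-square P Q r ta≡r+sb) ⟩
    4 * P * Q + r * r + (4 * (P + Q) + 4)        <⟨ +-monoˡ-< (4 * (P + Q) + 4) (+-monoʳ-< (4 * P * Q) slack) ⟩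
    4 * P * Q + 4 * (c * w) + (4 * (P + Q) + 4)  ≡⟨ regroup t a s b c w ⟩
    4 * (s * t) * (a * b) + 4 * (c * w + t * a + s * b) + 4
      ≡⟨ cong (λ x → 4 * (s * t) * (a * b) + 4 * x + 4) cw+ta+sb≡st+ab ⟩
    4 * (s * t) * (a * b) + 4 * (s * t + a * b) + 4
      ≡⟨ factor (s * t) (a * b) ⟩
    4 * (s * t + 1) * (a * b + 1)                ∎
    where
    open ≤-Reasoning
    P Q : ℕ
    P = t * a
    Q = s * b
    slack : r * r < 4 * (c * w)
    slack = addition-slack (subst (r <_) s≡a+c r<s) a≤1+c 1≤c (subst₂ _≤_ s≡a+c t≡b+w s≤t)
                           (subst₂ (λ s t → s * w ≡ t * c + r) s≡a+c t≡b+w sw≡tc+r)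
    split : ∀ a b c w → c * w + (b + w) * a + (a + c) * b ≡ (a + c) * (b + w) + a * b
    split = solve-∀
    cw+ta+sb≡st+ab : c * w + t * a + s * b ≡ s * t + a * b
    cw+ta+sb≡st+ab =
      subst₂ (λ s t → c * w + t * a + s * b ≡ s * t + a * b) (sym s≡a+c) (sym t≡b+w) (split a b c w)
    expand-succ : ∀ P Q → (P + Q + 2) * (P + Q + 2) ≡ (P + Q) * (P + Q) + (4 * (P + Q) + 4)
    expand-succ = solve-∀
    regroup : ∀ t a s b c w → 4 * (t * a) * (s * b) + 4 * (c * w) + (4 * (t * a + s * b) + 4)
                              ≡ 4 * (s * t) * (a * b) + 4 * (c * w + t * a + s * b) + 4
    regroup = solve-∀
    factor : ∀ x y → 4 * x * y + 4 * (x + y) + 4 ≡ 4 * (x + 1) * (y + 1)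
    factor = solve-∀

-- Single-edge witnesses

EditWitness : ∀ {n} → (Graph n → Graph n → Set) → Graph n → ℕ → Set
EditWitness R G k = ∃ λ H → R G H × PosMod H × dist G H ≡ k

deletion-witness : ∀ {s t} → 2 ≤ s → s ≤ t → EditWitness Deletion (K s t) 1
deletion-witness {s} {t} 2≤s s≤t =
  H , ⊕-single-deletion u<v (K s t) (K-adj-↑ˡ↑ʳ i j) , clustered⇒posMod H A gap , dist-single u<v (K s t)
  where
  B : BalancedSplit s t
  B = balancedSplit 2≤s
  open BalancedSplit B
  i : Fin s
  i = fromℕ< (<-≤-trans (s≤s z≤n) 2≤s)
  j : Fin t
  j = fromℕ< (b<t B s≤t)
  u<v : toℕ (i ↑ˡ t) < toℕ (s ↑ʳ j)
  u<v = ↑ˡ<↑ʳ i j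
  H : Graph (s + t)
  H = K s t ⊕ single u<v
  A : Subset (s + t)
  A = block s a b
  a≤s : a ≤ s
  a≤s = subst (a ≤_) (sym s≡a+c) (m≤m+n a c)
  b≤t : b ≤ t
  b≤t = <⇒≤ (b<t B s≤t)
  u∈A : A (i ↑ˡ t) ≡ true
  u∈A = trans (block-↑ˡ a b i) (trans (cong (_<ᵇ a) (toℕ-fromℕ< _)) (<ᵇ-true (≤-trans 1≤c c≤a)))
  v∉A : A (s ↑ʳ j) ≡ false
  v∉A = trans (block-↑ʳ {s} a b j) (trans (cong (_<ᵇ b) (toℕ-fromℕ< _)) (<ᵇ-false (≤-refl {b})))
  gap : vol H A * vol H A < 4 * edges H * eIn H A
  gap = let m≡ , e≡ , v≡ = remove-cut-edge u<v (K s t) A (K-adj-↑ˡ↑ʳ i j) u∈A v∉A in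
    subst (λ e → vol H A * vol H A < 4 * edges H * e) (trans (sym (eIn-block a b a≤s b≤t)) e≡)
          (deletion-gap B s≤t (trans (sym m≡) (edges-K {s} {t})) (trans (sym v≡) (vol-block a b a≤s b≤t)))

addition-witness : ∀ {s t} a b → a ≤ s → 2 ≤ b → b ≤ t →
                   (t * a + s * b + 2) * (t * a + s * b + 2) < 4 * (s * t + 1) * (a * b + 1) →
                   EditWitness Addition (K s t) 1
addition-witness {s} {t} a b a≤s 2≤b b≤t gap =
  H , ⊕-single-addition u<v (K s t) (K-adj-↑ʳ↑ʳ {s} j₀ j₁) , clustered⇒posMod H A gap′ , dist-single u<v (K s t)
  where
  j₀ j₁ : Fin t
  j₀ = fromℕ< (<-≤-trans (s≤s z≤n) (≤-trans 2≤b b≤t))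
  j₁ = fromℕ< (≤-trans 2≤b b≤t)
  u<v : toℕ (s ↑ʳ j₀) < toℕ (s ↑ʳ j₁)
  u<v = subst₂ _<_ (sym (trans (toℕ-↑ʳ s j₀) (cong (s +_) (toℕ-fromℕ< _))))
                   (sym (trans (toℕ-↑ʳ s j₁) (cong (s +_) (toℕ-fromℕ< _))))
                   (+-monoʳ-< s (s≤s z≤n))
  H : Graph (s + t)
  H = K s t ⊕ single u<v
  A : Subset (s + t)
  A = block s a b
  u∈A : A (s ↑ʳ j₀) ≡ true
  u∈A = trans (block-↑ʳ {s} a b j₀) (trans (cong (_<ᵇ b) (toℕ-fromℕ< _)) (<ᵇ-true (<-≤-trans (s≤s z≤n) 2≤b)))
  v∈A : A (s ↑ʳ j₁) ≡ true
  v∈A = trans (block-↑ʳ {s} a b j₁) (trans (cong (_<ᵇ b) (toℕ-fromℕ< _)) (<ᵇ-true 2≤b))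
  gap′ : vol H A * vol H A < 4 * edges H * eIn H A
  gap′ = let m≡ , e≡ , v≡ = add-inner-edge u<v (K s t) A (K-adj-↑ʳ↑ʳ {s} j₀ j₁) u∈A v∈A in
    subst₂ (λ v x → v * v < x)
           (sym (trans v≡ (cong (_+ 2) (vol-block a b a≤s b≤t))))
           (sym (cong₂ (λ m e → 4 * m * e) (trans m≡ (cong (_+ 1) (edges-K {s} {t})))
                                           (trans e≡ (cong (_+ 1) (eIn-block a b a≤s b≤t)))))
           gap

addition-witness-balanced : ∀ {s t} → 2 ≤ s → s ≤ t → 4 ≤ t → EditWitness Addition (K s t) 1
addition-witness-balanced {s} {t} 2≤s s≤t 4≤t =
  addition-witness a b (subst (a ≤_) (sym s≡a+c) (m≤m+n a c)) (2≤b B s≤t 4≤t) (<⇒≤ (b<t B s≤t))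
                   (addition-gap B s≤t)
  where
  B : BalancedSplit s t
  B = balancedSplit 2≤s
  open BalancedSplit B

star-addition-gap : ∀ {t} → 4 ≤ t → (t * 0 + 1 * 2 + 2) * (t * 0 + 1 * 2 + 2) < 4 * (1 * t + 1) * (0 * 2 + 1)
star-addition-gap {t} 4≤t = subst₂ _<_ (sym (lhs t)) (sym (rhs t)) (+-mono-≤ (*-monoʳ-≤ 4 4≤t) (s≤s (z≤n {3})))
  where
  lhs : ∀ t → (t * 0 + 1 * 2 + 2) * (t * 0 + 1 * 2 + 2) ≡ 16
  lhs = solve-∀
  rhs : ∀ t → 4 * (1 * t + 1) * (0 * 2 + 1) ≡ 4 * t + 4
  rhs = solve-∀

-- For t = 3 the balanced split has b = 1, too few to hold an edge, so other sets are used.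
addition-witness-K₂₃ : EditWitness Addition (K 2 3) 1
addition-witness-K₂₃ = addition-witness 1 2 (s≤s z≤n) (s≤s (s≤s z≤n)) (s≤s (s≤s z≤n)) (≤ᵇ⇒≤ 82 84 _)

addition-witness-K₃₃ : EditWitness Addition (K 3 3) 1
addition-witness-K₃₃ = addition-witness 2 2 (s≤s (s≤s z≤n)) (s≤s (s≤s z≤n)) (s≤s (s≤s z≤n)) (≤ᵇ⇒≤ 197 200 _)

addition-witness-2≤s : ∀ {s t} → 2 ≤ s → s ≤ t → 3 < t ⊎ 3 ≡ t → EditWitness Addition (K s t) 1
addition-witness-2≤s 2≤s s≤t (inj₁ 4≤t) = addition-witness-balanced 2≤s s≤t 4≤t
addition-witness-2≤s {2} _ _ (inj₂ refl) = addition-witness-K₂₃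
addition-witness-2≤s {3} _ _ (inj₂ refl) = addition-witness-K₃₃
addition-witness-2≤s {1} (s≤s ()) _ _
addition-witness-2≤s {suc (suc (suc (suc _)))} _ (s≤s (s≤s (s≤s ()))) (inj₂ refl)

addition-witnesses : ∀ {s t} → s ≤ t → (s ≡ 1 × t ≥ 4) ⊎ (s ≥ 2 × t ≥ 3) → EditWitness Addition (K s t) 1
addition-witnesses _   (inj₁ (refl , 4≤t)) =
  addition-witness 0 2 z≤n (s≤s (s≤s z≤n)) (≤-trans (s≤s (s≤s z≤n)) 4≤t) (star-addition-gap 4≤t)
addition-witnesses s≤t (inj₂ (2≤s , 3≤t)) = addition-witness-2≤s 2≤s s≤t (m≤n⇒m<n∨m≡n 3≤t)

-- Graphs on at most four vertices

subsets : ∀ n → List (Subset n)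
subsets zero    = (λ ()) ∷ []
subsets (suc n) = cartesianProductWith Vec._∷_ (true ∷ false ∷ []) (subsets n)

subsets-complete : ∀ {n} (A : Subset n) → ∃ λ B → B ∈ subsets n × (∀ i → A i ≡ B i)
subsets-complete {zero}  A = _ , here refl , λ ()
subsets-complete {suc n} A =
  let B , B∈ , A≗B = subsets-complete (A ∘ suc)
  in A zero Vec.∷ B , ∈-cartesianProductWith⁺ Vec._∷_ (bool∈ (A zero)) B∈ , λ { zero → refl ; (suc i) → A≗B i }
  where
  bool∈ : ∀ b → b ∈ true ∷ false ∷ []
  bool∈ true  = here refl
  bool∈ false = there (here refl)

cone : ∀ {n} → Subset n → Graph n → Graph (suc n)
cone {n} N G = record { adj = adjᶜ ; sym = symᶜ ; irrefl = irreflᶜ }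
  where
  adjᶜ : Fin (suc n) → Fin (suc n) → Bool
  adjᶜ zero    zero    = false
  adjᶜ zero    (suc j) = N j
  adjᶜ (suc i) zero    = N i
  adjᶜ (suc i) (suc j) = adj G i j
  symᶜ : ∀ i j → adjᶜ i j ≡ adjᶜ j i
  symᶜ zero    zero    = refl
  symᶜ zero    (suc j) = refl
  symᶜ (suc i) zero    = refl
  symᶜ (suc i) (suc j) = Graph.sym G i j
  irreflᶜ : ∀ i → adjᶜ i i ≡ false
  irreflᶜ zero    = refl
  irreflᶜ (suc i) = irrefl G i

tail : ∀ {n} → Graph (suc n) → Graph n
tail G = record
  { adj    = λ i j → adj G (suc i) (suc j)
  ; sym    = λ i j → Graph.sym G (suc i) (suc j)
  ; irrefl = irrefl G ∘ suc
  }

graphs : ∀ n → List (Graph n)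
graphs zero    = record { adj = λ () ; sym = λ () ; irrefl = λ () } ∷ []
graphs (suc n) = cartesianProductWith cone (subsets n) (graphs n)

graphs-complete : ∀ {n} (H : Graph n) → ∃ λ G → G ∈ graphs n × H ≅ G
graphs-complete {zero}  H = _ , here refl , λ ()
graphs-complete {suc n} H =
  let N , N∈ , ≗N = subsets-complete (λ j → adj H zero (suc j))
      G , G∈ , H′≅G = graphs-complete (tail H)
      H≅cone : H ≅ cone N G
      H≅cone = λ { zero zero → irrefl H zero ; zero (suc j) → ≗N j
                 ; (suc i) zero → trans (Graph.sym H (suc i) zero) (≗N i) ; (suc i) (suc j) → H′≅G i j }
  in cone N G , ∈-cartesianProductWith⁺ cone N∈ G∈ , H≅cone

unclustered? : ∀ {n} (G : Graph n) → Dec (∀ A → Unclustered G A)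
unclustered? {n} G = map′ sound complete (All.all? (λ A → 4 * edges G * eIn G A ≤? vol G A * vol G A) (subsets n))
  where
  sound : All (Unclustered G) (subsets n) → ∀ A → Unclustered G A
  sound all A = let B , B∈ , A≗B = subsets-complete A
                in unclustered-congʳ G (λ i → sym (A≗B i)) (All.lookup all B∈)
  complete : (∀ A → Unclustered G A) → All (Unclustered G) (subsets n)
  complete unclustered = All.tabulate λ {A} _ → unclustered A

¬posMod-by-search : ∀ {n} {P : Graph n → Set} → (∀ G H → G ≅ H → P G → P H) → (P? : ∀ G → Dec (P G)) →
                    True (All.all? (λ G → P? G →-dec unclustered? G) (graphs n)) → ∀ H → P H → ¬ PosMod H
¬posMod-by-search resp P? check H pH =
  let G , G∈ , H≅G = graphs-complete H
  in unclustered⇒¬posMod H λ A →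
       unclustered-cong G H (λ i j → sym (H≅G i j)) (All.lookup (toWitness check) G∈ (resp H G H≅G pH) A)

graph₂-¬posMod : ∀ (H : Graph 2) → ¬ PosMod H
graph₂-¬posMod H = ¬posMod-by-search {P = λ _ → ⊤} (λ _ _ _ _ → tt) (λ _ → yes tt) _ H tt

graph₃-¬posMod : ∀ (H : Graph 3) → ¬ PosMod H
graph₃-¬posMod H = ¬posMod-by-search {P = λ _ → ⊤} (λ _ _ _ _ → tt) (λ _ → yes tt) _ H tt

addition? : ∀ {n} (G H : Graph n) → Dec (Addition G H)
addition? G H = all? λ i → all? λ j → (adj G i j Bool.≟ true) →-dec (adj H i j Bool.≟ true)

addition-cong : ∀ {n} (G H H′ : Graph n) → H ≅ H′ → Addition G H → Addition G H′
addition-cong G H H′ H≅H′ G⊆H i j ij∈G = trans (sym (H≅H′ i j)) (G⊆H i j ij∈G)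

NearK₁₃orK₂₂ : Graph 4 → Set
NearK₁₃orK₂₂ H = Addition (K 1 3) H ⊎ Addition (K 2 2) H ⊎ dist (K 1 3) H ≤ 1

graph₄-¬posMod : ∀ H → NearK₁₃orK₂₂ H → ¬ PosMod H
graph₄-¬posMod =
  ¬posMod-by-search resp (λ H → addition? (K 1 3) H ⊎-dec addition? (K 2 2) H ⊎-dec dist (K 1 3) H ≤? 1) _
  where
  resp : ∀ G H → G ≅ H → NearK₁₃orK₂₂ G → NearK₁₃orK₂₂ H
  resp G H G≅H (inj₁ G⊇K₁₃)        = inj₁ (addition-cong (K 1 3) G H G≅H G⊇K₁₃)
  resp G H G≅H (inj₂ (inj₁ G⊇K₂₂)) = inj₂ (inj₁ (addition-cong (K 2 2) G H G≅H G⊇K₂₂))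
  resp G H G≅H (inj₂ (inj₂ d≤1))   = inj₂ (inj₂ (subst (_≤ 1) (dist-cong (K 1 3) G H G≅H) d≤1))

-- K₁,₃ without 0–3 and with 2–3 is the path 1–0–2–3; its set {0, 1} has vol² = 9 < 12 = 4m·e.
path₄ : Graph 4
path₄ = K 1 3 ⊕ single {u = 0F} {v = 3F} (s≤s z≤n) ⊕ single {u = 2F} {v = 3F} (s≤s (s≤s (s≤s z≤n)))

path₄-posMod : PosMod path₄
path₄-posMod = clustered⇒posMod path₄ (λ i → toℕ i <ᵇ 2) (≤ᵇ⇒≤ 10 12 _)

hasDelta-1 : ∀ {n} (R : Graph n → Graph n → Set) (G : Graph n) →
             (∀ A → Unclustered G A) → EditWitness R G 1 → HasDelta R G (fin 1)
hasDelta-1 _ G unclustered witness = witness , λ H _ → posMod⇒1≤dist G H unclustered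

any-edit : ∀ {n} (R : Graph n → Graph n → Set) (G : Graph n) {k} → EditWitness R G k → EditWitness AnyEdit G k
any-edit _ _ (H , _ , posMod , d≡k) = H , tt , posMod , d≡k

δ⁻-star : ∀ t → δ⁻ K 1 t ≡ ∞
δ⁻-star t = star-deletion-¬posMod

δ⁺-small : ∀ {s t} → (s ≡ 1 × t ≡ 1) ⊎ (s ≡ 1 × t ≡ 2) ⊎ (s ≡ 1 × t ≡ 3) ⊎ (s ≡ 2 × t ≡ 2) →
           δ⁺ K s t ≡ ∞
δ⁺-small (inj₁ (refl , refl))               H _   = graph₂-¬posMod H
δ⁺-small (inj₂ (inj₁ (refl , refl)))        H _   = graph₃-¬posMod H
δ⁺-small (inj₂ (inj₂ (inj₁ (refl , refl)))) H K⊆H = graph₄-¬posMod H (inj₁ K⊆H)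
δ⁺-small (inj₂ (inj₂ (inj₂ (refl , refl)))) H K⊆H = graph₄-¬posMod H (inj₂ (inj₁ K⊆H))

δ-small : ∀ {s t} → (s ≡ 1 × t ≡ 1) ⊎ (s ≡ 1 × t ≡ 2) → δ K s t ≡ ∞
δ-small (inj₁ (refl , refl)) H _ = graph₂-¬posMod H
δ-small (inj₂ (refl , refl)) H _ = graph₃-¬posMod H

δ-one : ∀ {s t} → s ≤ t → (s ≡ 1 × t ≥ 4) ⊎ s ≥ 2 → δ K s t ≡ fin 1
δ-one {s} {t} s≤t star-or-2≤s = hasDelta-1 AnyEdit (K s t) (K-unclustered s t) (witness star-or-2≤s)
  where
  witness : (s ≡ 1 × t ≥ 4) ⊎ s ≥ 2 → EditWitness AnyEdit (K s t) 1
  witness (inj₁ star) = any-edit Addition (K s t) (addition-witnesses s≤t (inj₁ star))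
  witness (inj₂ 2≤s)  = any-edit Deletion (K s t) (deletion-witness 2≤s s≤t)

δ-K₁₃ : δ K 1 3 ≡ fin 2
δ-K₁₃ = (path₄ , tt , path₄-posMod , refl)
      , λ H _ posMod → ≰⇒> λ d≤1 → graph₄-¬posMod H (inj₂ (inj₂ d≤1)) posMod

theorem1p2 : (s t : ℕ) → 1 ≤ s → s ≤ t →
    ((s ≡ 1 → δ⁻ K s t ≡ ∞) × (s ≥ 2 → δ⁻ K s t ≡ fin 1))
    × (((s ≡ 1 × t ≥ 4) ⊎ (s ≥ 2 × t ≥ 3) → δ⁺ K s t ≡ fin 1)
      × ((s ≡ 1 × t ≡ 1) ⊎ (s ≡ 1 × t ≡ 2) ⊎ (s ≡ 1 × t ≡ 3) ⊎ (s ≡ 2 × t ≡ 2)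
          → δ⁺ K s t ≡ ∞))
    × (((s ≡ 1 × t ≥ 4) ⊎ s ≥ 2 → δ K s t ≡ fin 1)
      × ((s ≡ 1 × t ≡ 1) ⊎ (s ≡ 1 × t ≡ 2) → δ K s t ≡ ∞)
      × (s ≡ 1 × t ≡ 3 → δ K s t ≡ fin 2))
theorem1p2 s t _ s≤t =
    ( (λ s≡1 → subst (λ s → δ⁻ K s t ≡ ∞) (sym s≡1) (δ⁻-star t))
    , (λ 2≤s → hasDelta-1 Deletion (K s t) (K-unclustered s t) (deletion-witness 2≤s s≤t)) )
  , ( (λ large → hasDelta-1 Addition (K s t) (K-unclustered s t) (addition-witnesses s≤t large))
    , δ⁺-small )
  , ( δ-one s≤t
    , δ-small
    , λ (s≡1 , t≡3) → subst₂ (λ s t → δ K s t ≡ fin 2) (sym s≡1) (sym t≡3) δ-K₁₃ )
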